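{- Let $n\ge 1$ and $i\ge 0$ be integers (and, in item (3), let $0\le k\le n$). Let $g=(g_0,g_1,\dots,g_{\lfloor d/2\rfloor})$ denote the $g$-vector of the relevant palindromic polynomial of palindromic degree $d$. Then: (1) If $g$ is the $g$-vector of $[n]!=\prod_{m=1}^n(1+q+\cdots+q^{m-1})$, then, with $d=\binom{n}{2}$, $$g_i=\sum_{j\ge 0}(-1)^j\,\bigl|\mathcal{T}(n,j)\times\mathcal{B}_d(i,j)\bigr|.$$ (2) If $g$ is the $g$-vector of $\prod_{m=1}^n(1+q^m)$, then, with $d=\binom{n+1}{2}$, $$g_i=\sum_{j\ge 0}(-1)^j\,\bigl|\mathcal{T}'(n,j)\times\mathcal{B}_d(i,j)\bigr|.$$ (3) If $g$ is the $g$-vector of the $q$-binomial coefficient $\left[{n\atop k}\right]_q=\frac{[n]!}{[k]!\,[n-k]!}$, then, with $d=k(n-k)$, $$g_i=\sum_{j\ge 0}(-1)^j\,\bigl|\mathcal{L}(n,k,j)\times\mathcal{B}_d(i,j)\bigr|.$$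
   Context: A polynomial $h(q)=\sum h_iq^i$ with integer coefficients is palindromic of palindromic degree $d$ if $q^dh(1/q)=h(q)$. Such an $h$ can be written uniquely as $h(q)=\sum_{0\le 2i\le d} g_i(q^i+q^{i+1}+\cdots+q^{d-i})$; the vector $(g_0,\dots,g_{\lfloor d/2\rfloor})$ is the $g$-vector of $h$ (equivalently $g_i=h_i-h_{i-1}$ for $i\le d/2$). Write $[m]=1+q+\cdots+q^{m-1}$ and $[m]!=[m][m-1]\cdots[1]$. Ballot paths: $\mathcal{B}_d(i,j)$ is the set of words in the letters $E,N$ of length $d-2j$ containing exactly $i-j$ letters $N$, such that every initial segment contains at least as many $E$'s as $N$'s (empty if $j>i$). Path matchings: $T(m,j)$ is the set of matchings (sets of pairwise disjoint edges) with exactly $j$ edges in the path graph on $m$ vertices (so $|T(m,j)|=\binom{m-j}{j}$). $\mathcal{T}(n,j)=\bigcup_{j_1+\cdots+j_{n-1}=j}T(1,j_1)\times T(2,j_2)\times\cdots\times T(n-1,j_{n-1})$, i.e. $(n-1)$-tuples of matchings of paths with $1,2,\dots,n-1$ vertices having $j$ edges in total. Cycle matchings: $T'(m,j)$ is the set of matchings with $j$ edges of the $m$-cycle graph (the cycle with $m$ vertices and $m$ edges; for $m=1$ a single vertex with a loop, which cannot be used in a matching; for $m=2$ two vertices joined by two parallel edges), so $|T'(m,j)|=\frac{m}{m-j}\binom{m-j}{j}$. $\mathcal{T}'(n,j)=\bigcup_{j_1+\cdots+j_n=j}T'(1,j_1)\times\cdots\times T'(n,j_n)$. Lucanomial matchings: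 a partition $\lambda=(\lambda_1\ge\cdots\ge\lambda_k\ge 0)$ fits in a $k\times(n-k)$ rectangle if $\lambda_1\le n-k$. Its complement is $\lambda^*=(\lambda^*_1,\dots,\lambda^*_{n-k})$ with $\lambda^*_r=k-\#\{s:\lambda_s\ge n-k+1-r\}$. A matching of a path is strict if its first vertex is not isolated (the empty path has exactly one strict matching, the empty one; the one-vertex path has none). $\mathcal{L}(n,k,j)$ is the set of all pairs $(\lambda,(M_1,\dots,M_k,M'_1,\dots,M'_{n-k}))$ with $\lambda$ fitting in the $k\times(n-k)$ rectangle, $M_r$ a matching of the path with $\lambda_r$ vertices, $M'_r$ a strict matching of the path with $\lambda^*_r$ vertices, and the total number of edges equal to $j$. -}

module Defs where

open import Data.Nat as ℕ using (ℕ; zero; suc; _∸_; _≤ᵇ_; _≡ᵇ_)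
open import Data.Integer as ℤ using (ℤ; +_)
open import Data.List using (List; []; _∷_; [_]; _++_; map; replicate; length; foldr;
  concatMap; filterᵇ; upTo; inits; cartesianProduct)
open import Data.Bool.ListAction using (all; any)
open import Data.Nat.ListAction using (sum)
open import Data.Bool using (Bool; true; false; _∧_; _∨_; not; if_then_else_)
open import Data.Fin using (Fin; zero; suc; fromℕ)
open import Data.Fin.Properties using (_≟_)
open import Data.Product using (_×_; _,_; proj₁; proj₂)
open import Relation.Nullary using (does)
open import Function using (id)

-- Polynomials in q with integer coefficients, as coefficient lists
-- (entry t = coefficient of q^t).

Poly : Set
Poly = List ℤ

infixl 6 _+ₚ_
infixl 7 _*ₚ_

_+ₚ_ : Poly → Poly → Poly
[] +ₚ q = q
(a ∷ p) +ₚ [] = a ∷ p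
(a ∷ p) +ₚ (b ∷ q) = (a ℤ.+ b) ∷ (p +ₚ q)

_*ₚ_ : Poly → Poly → Poly
[] *ₚ q = []
(a ∷ p) *ₚ q = map (a ℤ.*_) q +ₚ (ℤ.0ℤ ∷ (p *ₚ q))

coeff : Poly → ℕ → ℤ
coeff [] t = ℤ.0ℤ
coeff (a ∷ p) zero = a
coeff (a ∷ p) (suc t) = coeff p t

onePoly : Poly
onePoly = [ + 1 ]

prodP : List Poly → Poly
prodP = foldr _*ₚ_ onePoly

qpow : ℕ → Poly
qpow m = replicate m ℤ.0ℤ ++ [ + 1 ]

qint : ℕ → Poly
qint m = replicate m (+ 1)

oneTo : ℕ → List ℕ
oneTo n = map suc (upTo n)

qfact : ℕ → Poly
qfact n = prodP (map qint (oneTo n))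

prodOnePlusQ : ℕ → Poly
prodOnePlusQ n = prodP (map (λ m → onePoly +ₚ qpow m) (oneTo n))

-- g-vector entry g_i = h_i - h_{i-1} (with h_{-1} = 0), for i ≤ d/2
gvec : Poly → ℕ → ℤ
gvec h zero = coeff h zero
gvec h (suc i) = coeff h (suc i) ℤ.- coeff h i

seqs : {A : Set} → List (List A) → List (List A)
seqs [] = [ [] ]
seqs (xs ∷ xss) = concatMap (λ x → map (x ∷_) (seqs xss)) xs

allBools : ℕ → List (List Bool)
allBools L = seqs (replicate L (false ∷ true ∷ []))

selected : {A : Set} → List A → List Bool → List A
selected [] _ = []
selected (_ ∷ _) [] = []
selected (x ∷ xs) (true ∷ bs) = x ∷ selected xs bs
selected (x ∷ xs) (false ∷ bs) = selected xs bs

countTrue : List Bool → ℕ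
countTrue bs = length (filterᵇ id bs)

-- Multigraphs on vertex set Fin m, given by a list of edges (loops and
-- parallel edges allowed).  A subset of the edges is encoded by a Bool
-- list indexed by the edge list.

Edge : ℕ → Set
Edge m = Fin m × Fin m

_==_ : {m : ℕ} → Fin m → Fin m → Bool
a == b = does (a ≟ b)

disjointᵇ : {m : ℕ} → Edge m → Edge m → Bool
disjointᵇ (a , b) (c , d) = not ((a == c) ∨ (a == d) ∨ (b == c) ∨ (b == d))

nonLoopᵇ : {m : ℕ} → Edge m → Bool
nonLoopᵇ (a , b) = not (a == b)

isMatchingᵇ : {m : ℕ} → List (Edge m) → Bool
isMatchingᵇ [] = true
isMatchingᵇ (e ∷ es) = nonLoopᵇ e ∧ all (disjointᵇ e) es ∧ isMatchingᵇ es

matchings : {m : ℕ} → List (Edge m) → List (List Bool)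
matchings G = filterᵇ (λ s → isMatchingᵇ (selected G s)) (allBools (length G))

shiftE : {m : ℕ} → Edge m → Edge (suc m)
shiftE (a , b) = (suc a , suc b)

pathEdges : (m : ℕ) → List (Edge m)
pathEdges zero = []
pathEdges (suc zero) = []
pathEdges (suc (suc m)) = (zero , suc zero) ∷ map shiftE (pathEdges (suc m))

-- cycle graph on m vertices (m edges): path edges plus {m-1, 0};
-- for m = 1 this is a loop, for m = 2 two parallel edges.
cycleEdges : (m : ℕ) → List (Edge m)
cycleEdges zero = []
cycleEdges (suc m) = pathEdges (suc m) ++ [ (fromℕ m , zero) ]

pathMatchings : ℕ → List (List Bool)
pathMatchings m = matchings (pathEdges m)

cycleMatchings : ℕ → List (List Bool)
cycleMatchings m = matchings (cycleEdges m)

-- strict matchings of the path on m vertices: first vertex not isolated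
-- (the empty path has the single empty strict matching)
strictMatchings : ℕ → List (List Bool)
strictMatchings zero = pathMatchings zero
strictMatchings (suc m) =
  filterᵇ (λ s → any (λ e → (proj₁ e == zero) ∨ (proj₂ e == zero))
                     (selected (pathEdges (suc m)) s))
          (pathMatchings (suc m))

totalEdges : List (List Bool) → ℕ
totalEdges t = sum (map countTrue t)

𝒯 : ℕ → ℕ → List (List (List Bool))
𝒯 n j = filterᵇ (λ t → totalEdges t ≡ᵇ j)
                (seqs (map pathMatchings (oneTo (n ∸ 1))))

𝒯′ : ℕ → ℕ → List (List (List Bool))
𝒯′ n j = filterᵇ (λ t → totalEdges t ≡ᵇ j)
                 (seqs (map cycleMatchings (oneTo n)))

weaklyDecreasingᵇ : List ℕ → Bool
weaklyDecreasingᵇ [] = true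
weaklyDecreasingᵇ (x ∷ []) = true
weaklyDecreasingᵇ (x ∷ y ∷ xs) = (y ≤ᵇ x) ∧ weaklyDecreasingᵇ (y ∷ xs)

partitionsIn : (n k : ℕ) → List (List ℕ)
partitionsIn n k = filterᵇ weaklyDecreasingᵇ (seqs (replicate k (upTo (suc (n ∸ k)))))

countᵇ : {A : Set} → (A → Bool) → List A → ℕ
countᵇ p xs = length (filterᵇ p xs)

complementP : (n k : ℕ) → List ℕ → List ℕ
complementP n k lam =
  map (λ r → k ∸ countᵇ (λ x → (suc (n ∸ k) ∸ r) ≤ᵇ x) lam) (oneTo (n ∸ k))

ℒ : ℕ → ℕ → ℕ → List (List ℕ × List (List Bool))
ℒ n k j =
  filterᵇ (λ p → totalEdges (proj₂ p) ≡ᵇ j)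
    (concatMap (λ lam → map (lam ,_)
                 (seqs (map pathMatchings lam ++ map strictMatchings (complementP n k lam))))
               (partitionsIn n k))

data Step : Set where
  E N : Step

isN : Step → Bool
isN E = false
isN N = true

isE : Step → Bool
isE s = not (isN s)

ballotᵇ : List Step → Bool
ballotᵇ w = all (λ u → countᵇ isN u ≤ᵇ countᵇ isE u) (inits w)

ℬ : ℕ → ℕ → ℕ → List (List Step)
ℬ d i j =
  if (j ≤ᵇ i) ∧ ((2 ℕ.* j) ≤ᵇ d)
  then filterᵇ (λ w → (countᵇ isN w ≡ᵇ (i ∸ j)) ∧ ballotᵇ w)
               (seqs (replicate (d ∸ 2 ℕ.* j) (E ∷ N ∷ [])))
  else []

-- Σ_{j=0}^{i} (-1)^j c(j)   (terms with j > i vanish since ℬ d i j = ∅)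
altSum : ℕ → (ℕ → ℕ) → ℤ
altSum i c = foldr ℤ._+_ ℤ.0ℤ (map (λ j → ((ℤ.- (+ 1)) ℤ.^ j) ℤ.* (+ c j)) (upTo (suc i)))

-- Write γ(e,u) = (-q)^e (1+q)^u.  Every polynomial h
-- of palindromic degree d considered here is exhibited as a sum
--     h = Σ_{x ∈ T} γ(w x, d - 2 w x)
-- over an explicit finite set T of (tuples of) matchings, w x being the number
-- of edges.  Since the i-th entry of the g-vector of γ(e, d-2e) is
-- (-1)^e |ℬ_d(i,e)| (a ballot/reflection count), the g-vector of h is the
-- alternating sum of the theorem.

module Submission where

open import Defs
open import Data.Nat using (ℕ; _≤_; _*_; _∸_; suc)
open import Data.Nat.Combinatorics using (_C_)
open import Data.List using (length; cartesianProduct)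
open import Data.Product using (_×_; _,_)
open import Relation.Binary.PropositionalEquality using (_≡_)

-- Polynomials (coefficient lists) modulo coefficientwise equality form a
-- commutative ring; this lets us use the ring solver on polynomial identities.
module PolynomialRing where

  open import Data.Integer as ℤ using (ℤ; +_; 0ℤ; 1ℤ)
  import Data.Integer.Properties as ℤP
  open import Data.List using ([]; _∷_; map)
  open import Data.Nat using (zero; suc)
  open import Data.Product using (_,_)
  open import Data.Maybe using (nothing)
  open import Level using (0ℓ)
  open import Relation.Binary.PropositionalEquality
  open import Relation.Binary.Bundles using (Setoid)
  open import Relation.Binary.Structures using (IsEquivalence)
  open import Algebra.Bundles using (CommutativeRing)
  open import Tactic.RingSolver.Core.AlmostCommutativeRing
    using (AlmostCommutativeRing; fromCommutativeRing)

  -- Two coefficient lists are equal as polynomials when all coefficients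
  -- agree (trailing zeros do not matter).
  infix 4 _≈_
  record _≈_ (p r : Poly) : Set where
    constructor coeffwise
    field at : ∀ t → coeff p t ≡ coeff r t
  open _≈_ public

  ≈-refl : ∀ {p} → p ≈ p
  ≈-refl = coeffwise λ t → refl

  ≈-reflexive : ∀ {p r} → p ≡ r → p ≈ r
  ≈-reflexive refl = ≈-refl

  ≈-sym : ∀ {p r} → p ≈ r → r ≈ p
  ≈-sym e = coeffwise λ t → sym (at e t)

  ≈-trans : ∀ {p r s} → p ≈ r → r ≈ s → p ≈ s
  ≈-trans e f = coeffwise λ t → trans (at e t) (at f t)

  ≈-isEquivalence : IsEquivalence _≈_
  ≈-isEquivalence = record { refl = ≈-refl ; sym = ≈-sym ; trans = ≈-trans }

  polySetoid : Setoid 0ℓ 0ℓ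
  polySetoid = record { Carrier = Poly ; _≈_ = _≈_ ; isEquivalence = ≈-isEquivalence }

  module ≈-Reasoning where
    open import Relation.Binary.Reasoning.Setoid polySetoid public

  scale : ℤ → Poly → Poly
  scale a p = map (a ℤ.*_) p

  shift : Poly → Poly
  shift p = 0ℤ ∷ p

  coeff-+ : ∀ p r t → coeff (p +ₚ r) t ≡ coeff p t ℤ.+ coeff r t
  coeff-+ [] r t = sym (ℤP.+-identityˡ _)
  coeff-+ (a ∷ p) [] t = sym (ℤP.+-identityʳ _)
  coeff-+ (a ∷ p) (b ∷ r) zero = refl
  coeff-+ (a ∷ p) (b ∷ r) (suc t) = coeff-+ p r t

  coeff-scale : ∀ a p t → coeff (scale a p) t ≡ a ℤ.* coeff p t
  coeff-scale a [] t = sym (ℤP.*-zeroʳ a)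
  coeff-scale a (b ∷ p) zero = refl
  coeff-scale a (b ∷ p) (suc t) = coeff-scale a p t

  +-cong : ∀ {p p' r r'} → p ≈ p' → r ≈ r' → p +ₚ r ≈ p' +ₚ r'
  +-cong {p} {p'} {r} {r'} e f = coeffwise λ t → begin
    coeff (p +ₚ r) t       ≡⟨ coeff-+ p r t ⟩
    coeff p t ℤ.+ coeff r t ≡⟨ cong₂ ℤ._+_ (at e t) (at f t) ⟩
    coeff p' t ℤ.+ coeff r' t ≡⟨ coeff-+ p' r' t ⟨
    coeff (p' +ₚ r') t ∎
    where open ≡-Reasoning

  +-comm : ∀ p r → p +ₚ r ≈ r +ₚ p
  +-comm p r = coeffwise λ t →
    trans (coeff-+ p r t) (trans (ℤP.+-comm (coeff p t) _) (sym (coeff-+ r p t)))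

  +-assoc : ∀ p r s → (p +ₚ r) +ₚ s ≈ p +ₚ (r +ₚ s)
  +-assoc p r s = coeffwise λ t → begin
    coeff ((p +ₚ r) +ₚ s) t                      ≡⟨ coeff-+ (p +ₚ r) s t ⟩
    coeff (p +ₚ r) t ℤ.+ coeff s t               ≡⟨ cong (ℤ._+ coeff s t) (coeff-+ p r t) ⟩
    (coeff p t ℤ.+ coeff r t) ℤ.+ coeff s t      ≡⟨ ℤP.+-assoc (coeff p t) _ _ ⟩
    coeff p t ℤ.+ (coeff r t ℤ.+ coeff s t)      ≡⟨ cong (λ z → coeff p t ℤ.+ z) (coeff-+ r s t) ⟨
    coeff p t ℤ.+ coeff (r +ₚ s) t               ≡⟨ coeff-+ p (r +ₚ s) t ⟨
    coeff (p +ₚ (r +ₚ s)) t ∎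
    where open ≡-Reasoning

  +-identityʳ : ∀ p → p +ₚ [] ≈ p
  +-identityʳ p = coeffwise λ t → trans (coeff-+ p [] t) (ℤP.+-identityʳ _)

  scale-cong : ∀ a {p p'} → p ≈ p' → scale a p ≈ scale a p'
  scale-cong a {p} {p'} e = coeffwise λ t →
    trans (coeff-scale a p t) (trans (cong (a ℤ.*_) (at e t)) (sym (coeff-scale a p' t)))

  shift-cong : ∀ {p p'} → p ≈ p' → shift p ≈ shift p'
  shift-cong e = coeffwise λ { zero → refl ; (suc t) → at e t }

  scale-+ : ∀ a p r → scale a (p +ₚ r) ≈ scale a p +ₚ scale a r
  scale-+ a p r = coeffwise λ t → begin
    coeff (scale a (p +ₚ r)) t                   ≡⟨ coeff-scale a (p +ₚ r) t ⟩
    a ℤ.* coeff (p +ₚ r) t                       ≡⟨ cong (a ℤ.*_) (coeff-+ p r t) ⟩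
    a ℤ.* (coeff p t ℤ.+ coeff r t)              ≡⟨ ℤP.*-distribˡ-+ a (coeff p t) _ ⟩
    a ℤ.* coeff p t ℤ.+ a ℤ.* coeff r t          ≡⟨ cong₂ ℤ._+_ (coeff-scale a p t) (coeff-scale a r t) ⟨
    coeff (scale a p) t ℤ.+ coeff (scale a r) t  ≡⟨ coeff-+ (scale a p) (scale a r) t ⟨
    coeff (scale a p +ₚ scale a r) t ∎
    where open ≡-Reasoning

  scale-+ˡ : ∀ a b p → scale (a ℤ.+ b) p ≈ scale a p +ₚ scale b p
  scale-+ˡ a b p = coeffwise λ t → begin
    coeff (scale (a ℤ.+ b) p) t                  ≡⟨ coeff-scale (a ℤ.+ b) p t ⟩
    (a ℤ.+ b) ℤ.* coeff p t                      ≡⟨ ℤP.*-distribʳ-+ (coeff p t) a b ⟩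
    a ℤ.* coeff p t ℤ.+ b ℤ.* coeff p t          ≡⟨ cong₂ ℤ._+_ (coeff-scale a p t) (coeff-scale b p t) ⟨
    coeff (scale a p) t ℤ.+ coeff (scale b p) t  ≡⟨ coeff-+ (scale a p) (scale b p) t ⟨
    coeff (scale a p +ₚ scale b p) t ∎
    where open ≡-Reasoning

  scale-scale : ∀ a b p → scale a (scale b p) ≈ scale (a ℤ.* b) p
  scale-scale a b p = coeffwise λ t →
    trans (coeff-scale a (scale b p) t) (trans (cong (a ℤ.*_) (coeff-scale b p t))
      (trans (sym (ℤP.*-assoc a b _)) (sym (coeff-scale (a ℤ.* b) p t))))

  scale-comm : ∀ a b p → scale a (scale b p) ≈ scale b (scale a p)
  scale-comm a b p = ≈-trans (scale-scale a b p)
    (≈-trans (≈-reflexive (cong (λ c → scale c p) (ℤP.*-comm a b))) (≈-sym (scale-scale b a p)))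

  scale-shift : ∀ a p → scale a (shift p) ≈ shift (scale a p)
  scale-shift a p = coeffwise λ { zero → ℤP.*-zeroʳ a ; (suc t) → refl }

  scale-one : ∀ p → scale 1ℤ p ≈ p
  scale-one p = coeffwise λ t → trans (coeff-scale 1ℤ p t) (ℤP.*-identityˡ _)

  scale-zero : ∀ p → scale 0ℤ p ≈ []
  scale-zero p = coeffwise λ t → trans (coeff-scale 0ℤ p t) (ℤP.*-zeroˡ (coeff p t))

  shift-+ : ∀ p r → shift (p +ₚ r) ≈ shift p +ₚ shift r
  shift-+ p r = coeffwise λ { zero → refl ; (suc t) → refl }

  shift-[] : shift [] ≈ []
  shift-[] = coeffwise λ { zero → refl ; (suc t) → refl }

  open ≈-Reasoning

  *-congʳ : ∀ p {r r'} → r ≈ r' → p *ₚ r ≈ p *ₚ r'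
  *-congʳ [] e = ≈-refl
  *-congʳ (a ∷ p) e = +-cong (scale-cong a e) (shift-cong (*-congʳ p e))

  *-zero-cong : ∀ p r → p ≈ [] → p *ₚ r ≈ []
  *-zero-cong [] r e = ≈-refl
  *-zero-cong (a ∷ p) r e = begin
    scale a r +ₚ shift (p *ₚ r) ≈⟨ +-cong scale-a (shift-cong (*-zero-cong p r tail≈[])) ⟩
    [] +ₚ shift []              ≈⟨ shift-[] ⟩
    [] ∎
    where
    scale-a : scale a r ≈ []
    scale-a = ≈-trans (≈-reflexive (cong (λ c → scale c r) (at e zero))) (scale-zero r)
    tail≈[] : p ≈ []
    tail≈[] = coeffwise λ t → at e (suc t)

  *-congˡ : ∀ {p p'} r → p ≈ p' → p *ₚ r ≈ p' *ₚ r
  *-congˡ {[]} {p'} r e = ≈-sym (*-zero-cong p' r (≈-sym e))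
  *-congˡ {a ∷ p} {[]} r e = *-zero-cong (a ∷ p) r e
  *-congˡ {a ∷ p} {b ∷ p'} r e with at e zero
  ... | refl = +-cong ≈-refl (shift-cong (*-congˡ {p} {p'} r (coeffwise λ t → at e (suc t))))

  *-cong : ∀ {p p' r r'} → p ≈ p' → r ≈ r' → p *ₚ r ≈ p' *ₚ r'
  *-cong {p' = p'} {r = r} e f = ≈-trans (*-congˡ r e) (*-congʳ p' f)

  +-interchange : ∀ x y z w → (x +ₚ y) +ₚ (z +ₚ w) ≈ (x +ₚ z) +ₚ (y +ₚ w)
  +-interchange x y z w = begin
    (x +ₚ y) +ₚ (z +ₚ w) ≈⟨ +-assoc x y (z +ₚ w) ⟩
    x +ₚ (y +ₚ (z +ₚ w)) ≈⟨ +-cong (≈-refl {x}) (≈-sym (+-assoc y z w)) ⟩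
    x +ₚ ((y +ₚ z) +ₚ w) ≈⟨ +-cong (≈-refl {x}) (+-cong (+-comm y z) (≈-refl {w})) ⟩
    x +ₚ ((z +ₚ y) +ₚ w) ≈⟨ +-cong (≈-refl {x}) (+-assoc z y w) ⟩
    x +ₚ (z +ₚ (y +ₚ w)) ≈⟨ +-assoc x z (y +ₚ w) ⟨
    (x +ₚ z) +ₚ (y +ₚ w) ∎

  *-distribʳ : ∀ p p' r → (p +ₚ p') *ₚ r ≈ p *ₚ r +ₚ p' *ₚ r
  *-distribʳ [] p' r = ≈-refl
  *-distribʳ (a ∷ p) [] r = ≈-sym (+-identityʳ _)
  *-distribʳ (a ∷ p) (b ∷ p') r = begin
    scale (a ℤ.+ b) r +ₚ shift ((p +ₚ p') *ₚ r)
      ≈⟨ +-cong (scale-+ˡ a b r) (≈-trans (shift-cong (*-distribʳ p p' r)) (shift-+ (p *ₚ r) (p' *ₚ r))) ⟩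
    (scale a r +ₚ scale b r) +ₚ (shift (p *ₚ r) +ₚ shift (p' *ₚ r))
      ≈⟨ +-interchange (scale a r) (scale b r) (shift (p *ₚ r)) (shift (p' *ₚ r)) ⟩
    (scale a r +ₚ shift (p *ₚ r)) +ₚ (scale b r +ₚ shift (p' *ₚ r)) ∎

  *-distribˡ : ∀ p r s → p *ₚ (r +ₚ s) ≈ p *ₚ r +ₚ p *ₚ s
  *-distribˡ [] r s = ≈-refl
  *-distribˡ (a ∷ p) r s = begin
    scale a (r +ₚ s) +ₚ shift (p *ₚ (r +ₚ s))
      ≈⟨ +-cong (scale-+ a r s) (≈-trans (shift-cong (*-distribˡ p r s)) (shift-+ (p *ₚ r) (p *ₚ s))) ⟩
    (scale a r +ₚ scale a s) +ₚ (shift (p *ₚ r) +ₚ shift (p *ₚ s))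
      ≈⟨ +-interchange (scale a r) (scale a s) (shift (p *ₚ r)) (shift (p *ₚ s)) ⟩
    (scale a r +ₚ shift (p *ₚ r)) +ₚ (scale a s +ₚ shift (p *ₚ s)) ∎

  *-scaleˡ : ∀ a p r → scale a p *ₚ r ≈ scale a (p *ₚ r)
  *-scaleˡ a [] r = ≈-refl
  *-scaleˡ a (b ∷ p) r = begin
    scale (a ℤ.* b) r +ₚ shift (scale a p *ₚ r)
      ≈⟨ +-cong (≈-sym (scale-scale a b r)) (≈-trans (shift-cong (*-scaleˡ a p r)) (≈-sym (scale-shift a (p *ₚ r)))) ⟩
    scale a (scale b r) +ₚ scale a (shift (p *ₚ r)) ≈⟨ scale-+ a (scale b r) (shift (p *ₚ r)) ⟨
    scale a (scale b r +ₚ shift (p *ₚ r)) ∎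

  *-scaleʳ : ∀ p a r → p *ₚ scale a r ≈ scale a (p *ₚ r)
  *-scaleʳ [] a r = ≈-refl
  *-scaleʳ (b ∷ p) a r = begin
    scale b (scale a r) +ₚ shift (p *ₚ scale a r)
      ≈⟨ +-cong (scale-comm b a r) (≈-trans (shift-cong (*-scaleʳ p a r)) (≈-sym (scale-shift a (p *ₚ r)))) ⟩
    scale a (scale b r) +ₚ scale a (shift (p *ₚ r)) ≈⟨ scale-+ a (scale b r) (shift (p *ₚ r)) ⟨
    scale a (scale b r +ₚ shift (p *ₚ r)) ∎

  *-shiftˡ : ∀ p r → shift p *ₚ r ≈ shift (p *ₚ r)
  *-shiftˡ p r = +-cong (scale-zero r) ≈-refl

  *-shiftʳ : ∀ p r → p *ₚ shift r ≈ shift (p *ₚ r)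
  *-shiftʳ [] r = ≈-sym shift-[]
  *-shiftʳ (a ∷ p) r = begin
    scale a (shift r) +ₚ shift (p *ₚ shift r) ≈⟨ +-cong (scale-shift a r) (shift-cong (*-shiftʳ p r)) ⟩
    shift (scale a r) +ₚ shift (shift (p *ₚ r)) ≈⟨ shift-+ (scale a r) (shift (p *ₚ r)) ⟨
    shift (scale a r +ₚ shift (p *ₚ r)) ∎

  *-zeroʳ : ∀ p → p *ₚ [] ≈ []
  *-zeroʳ [] = ≈-refl
  *-zeroʳ (a ∷ p) = ≈-trans (shift-cong (*-zeroʳ p)) shift-[]

  *-identityˡ : ∀ p → onePoly *ₚ p ≈ p
  *-identityˡ p = ≈-trans (+-cong (scale-one p) shift-[]) (+-identityʳ p)

  *-identityʳ : ∀ p → p *ₚ onePoly ≈ p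
  *-identityʳ [] = ≈-refl
  *-identityʳ (a ∷ p) = coeffwise λ
    { zero → trans (coeff-+ (scale a onePoly) (shift (p *ₚ onePoly)) zero)
                   (trans (ℤP.+-identityʳ _) (ℤP.*-identityʳ a))
    ; (suc t) → trans (coeff-+ (scale a onePoly) (shift (p *ₚ onePoly)) (suc t))
                      (trans (ℤP.+-identityˡ _) (at (*-identityʳ p) t)) }

  *-comm : ∀ p r → p *ₚ r ≈ r *ₚ p
  *-comm [] r = ≈-sym (*-zeroʳ r)
  *-comm (a ∷ p) r = begin
    scale a r +ₚ shift (p *ₚ r)
      ≈⟨ +-cong (≈-sym (≈-trans (*-scaleʳ r a onePoly) (scale-cong a (*-identityʳ r))))
                (≈-trans (shift-cong (*-comm p r)) (≈-sym (*-shiftʳ r p))) ⟩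
    r *ₚ scale a onePoly +ₚ r *ₚ shift p ≈⟨ *-distribˡ r (scale a onePoly) (shift p) ⟨
    r *ₚ (scale a onePoly +ₚ shift p) ≈⟨ *-congʳ r cons≈ ⟩
    r *ₚ (a ∷ p) ∎
    where
    cons≈ : scale a onePoly +ₚ shift p ≈ a ∷ p
    cons≈ = coeffwise λ { zero → trans (ℤP.+-identityʳ _) (ℤP.*-identityʳ a) ; (suc t) → refl }

  *-assoc : ∀ p r s → (p *ₚ r) *ₚ s ≈ p *ₚ (r *ₚ s)
  *-assoc [] r s = ≈-refl
  *-assoc (a ∷ p) r s = begin
    (scale a r +ₚ shift (p *ₚ r)) *ₚ s ≈⟨ *-distribʳ (scale a r) (shift (p *ₚ r)) s ⟩
    scale a r *ₚ s +ₚ shift (p *ₚ r) *ₚ s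
      ≈⟨ +-cong (*-scaleˡ a r s) (≈-trans (*-shiftˡ (p *ₚ r) s) (shift-cong (*-assoc p r s))) ⟩
    scale a (r *ₚ s) +ₚ shift (p *ₚ (r *ₚ s)) ∎

  negₚ : Poly → Poly
  negₚ = scale (ℤ.- 1ℤ)

  coeff-neg : ∀ p t → coeff (negₚ p) t ≡ ℤ.- coeff p t
  coeff-neg p t = trans (coeff-scale (ℤ.- 1ℤ) p t) (ℤP.-1*i≡-i (coeff p t))

  +-inverseʳ : ∀ p → p +ₚ negₚ p ≈ []
  +-inverseʳ p = coeffwise λ t → trans (coeff-+ p (negₚ p) t)
    (trans (cong (λ z → coeff p t ℤ.+ z) (coeff-neg p t)) (ℤP.+-inverseʳ (coeff p t)))

  polyRing : CommutativeRing 0ℓ 0ℓ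
  polyRing = record
    { Carrier = Poly ; _≈_ = _≈_ ; _+_ = _+ₚ_ ; _*_ = _*ₚ_ ; -_ = negₚ ; 0# = [] ; 1# = onePoly
    ; isCommutativeRing = record
      { isRing = record
        { +-isAbelianGroup = record
          { isGroup = record
            { isMonoid = record
              { isSemigroup = record
                { isMagma = record { isEquivalence = ≈-isEquivalence ; ∙-cong = +-cong }
                ; assoc = +-assoc }
              ; identity = (λ p → ≈-refl) , +-identityʳ }
            ; inverse = (λ p → ≈-trans (+-comm (negₚ p) p) (+-inverseʳ p)) , +-inverseʳ
            ; ⁻¹-cong = scale-cong (ℤ.- 1ℤ) }
          ; comm = +-comm }
        ; *-cong = *-cong
        ; *-assoc = *-assoc
        ; *-identity = *-identityˡ , *-identityʳ
        ; distrib = *-distribˡ , (λ p r s → *-distribʳ r s p) }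
      ; *-comm = *-comm } }

  polyAlmostRing : AlmostCommutativeRing 0ℓ 0ℓ
  polyAlmostRing = fromCommutativeRing polyRing (λ _ → nothing)

module ListTools where

  open import Data.Nat as ℕ using (ℕ)
  open import Data.List using (List; []; _∷_; _++_; map; length; filterᵇ; concatMap; cartesianProduct)
  import Data.List.Properties as LP
  open import Data.List.Relation.Unary.All as All using (All; []; _∷_)
  open import Data.Bool using (Bool; true; false; _∧_; T?)
  open import Data.Bool.ListAction using (all)
  open import Data.Product using (_,_)
  open import Function using (_∘_)
  open import Relation.Binary.PropositionalEquality

  module _ {A : Set} where

    filterᵇ-congAll : {P Q : A → Bool} {xs : List A} →
      All (λ x → P x ≡ Q x) xs → filterᵇ P xs ≡ filterᵇ Q xs
    filterᵇ-congAll [] = refl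
    filterᵇ-congAll {P} {Q} {x ∷ xs} (e ∷ es) rewrite e with Q x
    ... | true  = cong (x ∷_) (filterᵇ-congAll es)
    ... | false = filterᵇ-congAll es

    filterᵇ-none : {P : A → Bool} {xs : List A} → All (λ x → P x ≡ false) xs → filterᵇ P xs ≡ []
    filterᵇ-none [] = refl
    filterᵇ-none {P} {x ∷ xs} (e ∷ es) rewrite e = filterᵇ-none es

    filterᵇ-all : {P : A → Bool} {xs : List A} → All (λ x → P x ≡ true) xs → filterᵇ P xs ≡ xs
    filterᵇ-all [] = refl
    filterᵇ-all {P} {x ∷ xs} (e ∷ es) rewrite e = cong (x ∷_) (filterᵇ-all es)

    filterᵇ-filterᵇ : (P Q : A → Bool) (xs : List A) →
      filterᵇ P (filterᵇ Q xs) ≡ filterᵇ (λ x → Q x ∧ P x) xs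
    filterᵇ-filterᵇ P Q [] = refl
    filterᵇ-filterᵇ P Q (x ∷ xs) with Q x
    ... | false = filterᵇ-filterᵇ P Q xs
    ... | true with P x
    ...   | true  = cong (x ∷_) (filterᵇ-filterᵇ P Q xs)
    ...   | false = filterᵇ-filterᵇ P Q xs

    all-++ : (p : A → Bool) (xs ys : List A) → all p (xs ++ ys) ≡ all p xs ∧ all p ys
    all-++ p [] ys = refl
    all-++ p (x ∷ xs) ys with p x
    ... | true  = all-++ p xs ys
    ... | false = refl

    all-cong : {p p' : A → Bool} → (∀ x → p x ≡ p' x) → (xs : List A) → all p xs ≡ all p' xs
    all-cong e [] = refl
    all-cong e (x ∷ xs) = cong₂ _∧_ (e x) (all-cong e xs)

  module _ {A B : Set} where

    filterᵇ-map : (P : B → Bool) (f : A → B) (xs : List A) →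
      filterᵇ P (map f xs) ≡ map f (filterᵇ (P ∘ f) xs)
    filterᵇ-map P f [] = refl
    filterᵇ-map P f (x ∷ xs) with P (f x)
    ... | true  = cong (f x ∷_) (filterᵇ-map P f xs)
    ... | false = filterᵇ-map P f xs

    length-filterᵇ-map : (P : B → Bool) (f : A → B) (xs : List A) →
      length (filterᵇ P (map f xs)) ≡ length (filterᵇ (P ∘ f) xs)
    length-filterᵇ-map P f xs =
      trans (cong length (filterᵇ-map P f xs)) (LP.length-map f (filterᵇ (P ∘ f) xs))

    filterᵇ-concatMap : (P : B → Bool) (g : A → List B) (xs : List A) →
      filterᵇ P (concatMap g xs) ≡ concatMap (filterᵇ P ∘ g) xs
    filterᵇ-concatMap P g [] = refl
    filterᵇ-concatMap P g (x ∷ xs) =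
      trans (LP.filter-++ (T? ∘ P) (g x) (concatMap g xs))
            (cong (filterᵇ P (g x) ++_) (filterᵇ-concatMap P g xs))

    all-map : (p : B → Bool) (f : A → B) (xs : List A) → all p (map f xs) ≡ all (p ∘ f) xs
    all-map p f [] = refl
    all-map p f (x ∷ xs) = cong (p (f x) ∧_) (all-map p f xs)

    length-cartesianProduct : (xs : List A) (ys : List B) →
      length (cartesianProduct xs ys) ≡ length xs ℕ.* length ys
    length-cartesianProduct [] ys = refl
    length-cartesianProduct (x ∷ xs) ys =
      trans (LP.length-++ (map (x ,_) ys))
            (cong₂ ℕ._+_ (LP.length-map (x ,_) ys) (length-cartesianProduct xs ys))

  filterᵇ-all-seqs : {A : Set} (p : A → Bool) (xss : List (List A)) →
    filterᵇ (all p) (seqs xss) ≡ seqs (map (filterᵇ p) xss)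
  filterᵇ-all-seqs p [] = refl
  filterᵇ-all-seqs p (xs ∷ xss) =
    trans (filterᵇ-concatMap (all p) (λ x → map (x ∷_) (seqs xss)) xs) (go xs)
    where
    go : ∀ xs → concatMap (filterᵇ (all p) ∘ (λ x → map (x ∷_) (seqs xss))) xs
              ≡ concatMap (λ x → map (x ∷_) (seqs (map (filterᵇ p) xss))) (filterᵇ p xs)
    go [] = refl
    go (x ∷ xs) rewrite filterᵇ-map (all p) (x ∷_) (seqs xss) with p x
    ... | true  = cong₂ _++_ (cong (map (x ∷_)) (filterᵇ-all-seqs p xss)) (go xs)
    ... | false = trans (cong (λ l → map (x ∷_) l ++ concatMap (filterᵇ (all p) ∘ (λ x → map (x ∷_) (seqs xss))) xs)
                              (filterᵇ-none (All.universal (λ _ → refl) (seqs xss))))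
                        (go xs)

module PolySums where

  open PolynomialRing
  open import Data.Integer as ℤ using (ℤ)
  open import Data.Nat as ℕ using (ℕ; zero; suc)
  open import Data.List using (List; []; _∷_; _++_; map; foldr; concatMap; replicate)
  import Data.List.Properties as LP
  open import Data.List.Relation.Unary.All using (All; []; _∷_)
  open import Data.List.Relation.Binary.Permutation.Propositional as Perm using (_↭_; prep; swap)
  open import Function using (_∘_)
  open import Relation.Binary.PropositionalEquality

  Σₚ : List Poly → Poly
  Σₚ = foldr _+ₚ_ []

  Σₚ-++ : ∀ xs ys → Σₚ (xs ++ ys) ≈ Σₚ xs +ₚ Σₚ ys
  Σₚ-++ [] ys = ≈-refl
  Σₚ-++ (x ∷ xs) ys = ≈-trans (+-cong (≈-refl {x}) (Σₚ-++ xs ys)) (≈-sym (+-assoc x (Σₚ xs) (Σₚ ys)))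

  Σₚ-congAll : {A : Set} {F G : A → Poly} {xs : List A} →
    All (λ x → F x ≈ G x) xs → Σₚ (map F xs) ≈ Σₚ (map G xs)
  Σₚ-congAll [] = ≈-refl
  Σₚ-congAll (e ∷ es) = +-cong e (Σₚ-congAll es)

  Σₚ-cong : {A : Set} {F G : A → Poly} (xs : List A) → (∀ x → F x ≈ G x) → Σₚ (map F xs) ≈ Σₚ (map G xs)
  Σₚ-cong [] e = ≈-refl
  Σₚ-cong (x ∷ xs) e = +-cong (e x) (Σₚ-cong xs e)

  Σₚ-map : {A B : Set} (F : B → Poly) (g : A → B) (xs : List A) → Σₚ (map F (map g xs)) ≡ Σₚ (map (F ∘ g) xs)
  Σₚ-map F g xs = cong Σₚ (sym (LP.map-∘ xs))

  Σₚ-*ʳ : {A : Set} (F : A → Poly) (xs : List A) (P : Poly) →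
    Σₚ (map F xs) *ₚ P ≈ Σₚ (map (λ x → F x *ₚ P) xs)
  Σₚ-*ʳ F [] P = ≈-refl
  Σₚ-*ʳ F (x ∷ xs) P = ≈-trans (*-distribʳ (F x) (Σₚ (map F xs)) P) (+-cong (≈-refl {F x *ₚ P}) (Σₚ-*ʳ F xs P))

  Σₚ-*ˡ : {A : Set} (P : Poly) (F : A → Poly) (xs : List A) →
    P *ₚ Σₚ (map F xs) ≈ Σₚ (map (λ x → P *ₚ F x) xs)
  Σₚ-*ˡ P F xs = ≈-trans (*-comm P _) (≈-trans (Σₚ-*ʳ F xs P) (Σₚ-cong xs (λ x → *-comm (F x) P)))

  Σₚ-concatMap : {A B : Set} (F : B → Poly) (g : A → List B) (xs : List A) →
    Σₚ (map F (concatMap g xs)) ≈ Σₚ (map (λ x → Σₚ (map F (g x))) xs)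
  Σₚ-concatMap F g [] = ≈-refl
  Σₚ-concatMap F g (x ∷ xs) =
    ≈-trans (≈-reflexive (cong Σₚ (LP.map-++ F (g x) (concatMap g xs))))
    (≈-trans (Σₚ-++ (map F (g x)) (map F (concatMap g xs)))
             (+-cong (≈-refl {Σₚ (map F (g x))}) (Σₚ-concatMap F g xs)))

  Σₚ-↭ : {xs ys : List Poly} → xs ↭ ys → Σₚ xs ≈ Σₚ ys
  Σₚ-↭ Perm.refl = ≈-refl
  Σₚ-↭ (prep x p) = +-cong (≈-refl {x}) (Σₚ-↭ p)
  Σₚ-↭ {x ∷ y ∷ xs} {y ∷ x ∷ ys} (swap x y p) =
    ≈-trans (≈-sym (+-assoc x y (Σₚ xs))) (≈-trans (+-cong (+-comm x y) (Σₚ-↭ p)) (+-assoc y x (Σₚ ys)))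
  Σₚ-↭ (Perm.trans p q) = ≈-trans (Σₚ-↭ p) (Σₚ-↭ q)

  Πₚ-++ : ∀ xs ys → prodP (xs ++ ys) ≈ prodP xs *ₚ prodP ys
  Πₚ-++ [] ys = ≈-sym (*-identityˡ (prodP ys))
  Πₚ-++ (x ∷ xs) ys = ≈-trans (*-congʳ x (Πₚ-++ xs ys)) (≈-sym (*-assoc x (prodP xs) (prodP ys)))

  Πₚ-congAll : {A : Set} {F G : A → Poly} {xs : List A} →
    All (λ x → F x ≈ G x) xs → prodP (map F xs) ≈ prodP (map G xs)
  Πₚ-congAll [] = ≈-refl
  Πₚ-congAll (e ∷ es) = *-cong e (Πₚ-congAll es)

  Πₚ-cong : {A : Set} {F G : A → Poly} (xs : List A) → (∀ x → F x ≈ G x) → prodP (map F xs) ≈ prodP (map G xs)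
  Πₚ-cong [] e = ≈-refl
  Πₚ-cong (x ∷ xs) e = *-cong (e x) (Πₚ-cong xs e)

  infixr 8 _^ₚ_
  _^ₚ_ : Poly → ℕ → Poly
  p ^ₚ zero = onePoly
  p ^ₚ suc n = p *ₚ p ^ₚ n

  ^ₚ-+ : ∀ p a b → p ^ₚ (a ℕ.+ b) ≈ p ^ₚ a *ₚ p ^ₚ b
  ^ₚ-+ p zero b = ≈-sym (*-identityˡ (p ^ₚ b))
  ^ₚ-+ p (suc a) b = ≈-trans (*-congʳ p (^ₚ-+ p a b)) (≈-sym (*-assoc p (p ^ₚ a) (p ^ₚ b)))

  Πₚ-replicate : ∀ p d → prodP (replicate d p) ≈ p ^ₚ d
  Πₚ-replicate p zero = ≈-refl
  Πₚ-replicate p (suc d) = *-congʳ p (Πₚ-replicate p d)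

  gvec-cong : ∀ {p r} → p ≈ r → ∀ i → gvec p i ≡ gvec r i
  gvec-cong e zero = at e zero
  gvec-cong e (suc i) = cong₂ ℤ._-_ (at e (suc i)) (at e i)

  sumℤ : List ℤ → ℤ
  sumℤ = foldr ℤ._+_ ℤ.0ℤ

  sumℤ-congAll : {A : Set} {f g : A → ℤ} {xs : List A} → All (λ x → f x ≡ g x) xs → sumℤ (map f xs) ≡ sumℤ (map g xs)
  sumℤ-congAll [] = refl
  sumℤ-congAll (e ∷ es) = cong₂ ℤ._+_ e (sumℤ-congAll es)

  gvec-+ : ∀ p r i → gvec (p +ₚ r) i ≡ gvec p i ℤ.+ gvec r i
  gvec-+ p r zero = coeff-+ p r zero
  gvec-+ p r (suc i) =
    trans (cong₂ ℤ._-_ (coeff-+ p r (suc i)) (coeff-+ p r i))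
          (interchange (coeff p (suc i)) (coeff r (suc i)) (coeff p i) (coeff r i))
    where
    open import Data.Integer.Tactic.RingSolver
    interchange : ∀ a b c d → (a ℤ.+ b) ℤ.- (c ℤ.+ d) ≡ (a ℤ.- c) ℤ.+ (b ℤ.- d)
    interchange = solve-∀

  gvec-Σ : ∀ ps i → gvec (Σₚ ps) i ≡ sumℤ (map (λ p → gvec p i) ps)
  gvec-Σ [] zero = refl
  gvec-Σ [] (suc i) = refl
  gvec-Σ (p ∷ ps) i = trans (gvec-+ p (Σₚ ps) i) (cong (λ z → gvec p i ℤ.+ z) (gvec-Σ ps i))

module GammaBasis where

  open PolynomialRing
  open PolySums
  open import Data.Integer as ℤ using (ℤ; +_; 0ℤ; 1ℤ)
  import Data.Integer.Properties as ℤP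
  open import Data.Nat as ℕ using (ℕ; zero; suc)
  import Data.Nat.Properties as ℕP
  open import Data.List using ([]; _∷_)
  open import Relation.Binary.PropositionalEquality

  q -q 1+q : Poly
  q = 0ℤ ∷ 1ℤ ∷ []
  -q = 0ℤ ∷ ℤ.- 1ℤ ∷ []
  1+q = 1ℤ ∷ 1ℤ ∷ []

  -- γ(e,u) = (-q)^e (1+q)^u, palindromic of degree 2e+u.
  γ : ℕ → ℕ → Poly
  γ e u = -q ^ₚ e *ₚ 1+q ^ₚ u

  q+-q≈0 : q +ₚ -q ≈ []
  q+-q≈0 = coeffwise λ { zero → refl ; (suc zero) → refl ; (suc (suc t)) → refl }

  1+q≈1+q : 1+q ≈ onePoly +ₚ q
  1+q≈1+q = coeffwise λ { zero → refl ; (suc zero) → refl ; (suc (suc t)) → refl }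

  q*≈shift : ∀ p → q *ₚ p ≈ shift p
  q*≈shift p = ≈-trans (+-cong (scale-zero p) (shift-cong (*-identityˡ p))) ≈-refl

  γ-* : ∀ a b c d → γ a b *ₚ γ c d ≈ γ (a ℕ.+ c) (b ℕ.+ d)
  γ-* a b c d = begin
    γ a b *ₚ γ c d ≈⟨ solve 4 (λ A B C D → ((A ⊗ B) ⊗ (C ⊗ D)) ⊜ ((A ⊗ C) ⊗ (B ⊗ D))) ≈-refl
                        (-q ^ₚ a) (1+q ^ₚ b) (-q ^ₚ c) (1+q ^ₚ d) ⟩
    (-q ^ₚ a *ₚ -q ^ₚ c) *ₚ (1+q ^ₚ b *ₚ 1+q ^ₚ d) ≈⟨ *-cong (^ₚ-+ -q a c) (^ₚ-+ 1+q b d) ⟨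
    γ (a ℕ.+ c) (b ℕ.+ d) ∎
    where
    open ≈-Reasoning
    open import Tactic.RingSolver.NonReflective polyAlmostRing

  γ-sucˡ : ∀ e u → γ (suc e) u ≈ -q *ₚ γ e u
  γ-sucˡ e u = *-assoc -q (-q ^ₚ e) (1+q ^ₚ u)

  γ-sucʳ : ∀ e u → γ e (suc u) ≈ 1+q *ₚ γ e u
  γ-sucʳ e u = ≈-trans (≈-sym (γ-* 0 1 e u)) (*-congˡ (γ e u) (≈-trans (*-identityˡ _) (*-identityʳ 1+q)))

  1+q*≈ : ∀ p → 1+q *ₚ p ≈ p +ₚ shift p
  1+q*≈ p = ≈-trans (*-congˡ p 1+q≈1+q)
    (≈-trans (*-distribʳ onePoly q p) (+-cong (*-identityˡ p) (q*≈shift p)))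

  -q*≈ : ∀ p → -q *ₚ p ≈ shift (negₚ p)
  -q*≈ p = +-cong (scale-zero p)
    (shift-cong (≈-trans (+-cong (≈-refl {negₚ p}) shift-[]) (+-identityʳ (negₚ p))))

  coeff-1+q*-zero : ∀ p → coeff (1+q *ₚ p) zero ≡ coeff p zero
  coeff-1+q*-zero p = trans (at (1+q*≈ p) zero) (trans (coeff-+ p (shift p) zero) (ℤP.+-identityʳ _))

  coeff-1+q*-suc : ∀ p t → coeff (1+q *ₚ p) (suc t) ≡ coeff p (suc t) ℤ.+ coeff p t
  coeff-1+q*-suc p t = trans (at (1+q*≈ p) (suc t)) (coeff-+ p (shift p) (suc t))

  coeff--q*-zero : ∀ p → coeff (-q *ₚ p) zero ≡ 0ℤ
  coeff--q*-zero p = at (-q*≈ p) zero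

  coeff--q*-suc : ∀ p t → coeff (-q *ₚ p) (suc t) ≡ ℤ.- coeff p t
  coeff--q*-suc p t = trans (at (-q*≈ p) (suc t)) (coeff-neg p t)

  binomial : ℕ → ℕ → ℕ
  binomial L zero = 1
  binomial zero (suc t) = 0
  binomial (suc L) (suc t) = binomial L t ℕ.+ binomial L (suc t)

  coeff-1+q^ : ∀ u t → coeff (1+q ^ₚ u) t ≡ + binomial u t
  coeff-1+q^ zero zero = refl
  coeff-1+q^ zero (suc t) = refl
  coeff-1+q^ (suc u) zero = trans (coeff-1+q*-zero (1+q ^ₚ u)) (coeff-1+q^ u zero)
  coeff-1+q^ (suc u) (suc t) = begin
    coeff (1+q *ₚ 1+q ^ₚ u) (suc t)                    ≡⟨ coeff-1+q*-suc (1+q ^ₚ u) t ⟩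
    coeff (1+q ^ₚ u) (suc t) ℤ.+ coeff (1+q ^ₚ u) t   ≡⟨ cong₂ ℤ._+_ (coeff-1+q^ u (suc t)) (coeff-1+q^ u t) ⟩
    + binomial u (suc t) ℤ.+ + binomial u t           ≡⟨ ℤP.pos-+ (binomial u (suc t)) (binomial u t) ⟨
    + (binomial u (suc t) ℕ.+ binomial u t)           ≡⟨ cong +_ (ℕP.+-comm (binomial u (suc t)) (binomial u t)) ⟩
    + binomial (suc u) (suc t) ∎
    where open ≡-Reasoning

  gvec--q*-zero : ∀ p → gvec (-q *ₚ p) zero ≡ 0ℤ
  gvec--q*-zero = coeff--q*-zero

  gvec--q*-suc : ∀ p i → gvec (-q *ₚ p) (suc i) ≡ ℤ.- gvec p i
  gvec--q*-suc p zero = trans (cong₂ ℤ._-_ (coeff--q*-suc p zero) (coeff--q*-zero p)) (ℤP.+-identityʳ _)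
  gvec--q*-suc p (suc i) =
    trans (cong₂ ℤ._-_ (coeff--q*-suc p (suc i)) (coeff--q*-suc p i)) (neg-distrib (coeff p (suc i)) (coeff p i))
    where
    open import Data.Integer.Tactic.RingSolver
    neg-distrib : ∀ a b → ℤ.- a ℤ.- ℤ.- b ≡ ℤ.- (a ℤ.- b)
    neg-distrib = solve-∀

-- The key
-- input is the reflection principle: among the words with a letters N and
-- L-a letters E, those in which no prefix has more than h surplus letters N
-- number C(L,a) - C(L,a-h-1).
module BallotPaths where

  open PolynomialRing
  open PolySums
  open GammaBasis
  open ListTools
  open import Data.Integer as ℤ using (ℤ; +_)
  import Data.Integer.Properties as ℤP
  open import Data.Nat as ℕ using (ℕ; zero; suc; _∸_; _≤_; z≤n; s≤s; _≤ᵇ_; _≡ᵇ_)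
  import Data.Nat.Properties as ℕP
  open import Data.List using (List; []; _∷_; _++_; map; length; filterᵇ; replicate; inits)
  import Data.List.Properties as LP
  open import Data.List.Relation.Unary.All as All using (All)
  open import Data.Bool using (Bool; true; false; _∧_; if_then_else_; T?)
  open import Data.Bool.ListAction using (all)
  open import Data.Bool.Properties using (T-≡)
  open import Function using (_∘_)
  open import Function.Bundles using (Equivalence)
  open import Relation.Binary.PropositionalEquality

  suc≤ᵇsuc : ∀ m n → (suc m ≤ᵇ suc n) ≡ (m ≤ᵇ n)
  suc≤ᵇsuc zero n = refl
  suc≤ᵇsuc (suc m) n = refl

  ballotFrom : ℕ → List Step → Bool
  ballotFrom h w = all (λ u → countᵇ isN u ≤ᵇ h ℕ.+ countᵇ isE u) (inits w)

  words : ℕ → List (List Step)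
  words L = seqs (replicate L (E ∷ N ∷ []))

  isBallotWord : ℕ → ℕ → List Step → Bool
  isBallotWord h a w = (countᵇ isN w ≡ᵇ a) ∧ ballotFrom h w

  ballotCount : ℕ → ℕ → ℕ → ℕ
  ballotCount h L a = length (filterᵇ (isBallotWord h a) (words L))

  ballotFrom-E : ∀ h w → ballotFrom h (E ∷ w) ≡ ballotFrom (suc h) w
  ballotFrom-E h w =
    trans (all-map (λ u → countᵇ isN u ≤ᵇ h ℕ.+ countᵇ isE u) (E ∷_) (inits w))
          (all-cong (λ u → cong (countᵇ isN u ≤ᵇ_) (ℕP.+-suc h (countᵇ isE u))) (inits w))

  ballotFrom-N : ∀ h w → ballotFrom (suc h) (N ∷ w) ≡ ballotFrom h w
  ballotFrom-N h w =
    trans (all-map (λ u → countᵇ isN u ≤ᵇ suc h ℕ.+ countᵇ isE u) (N ∷_) (inits w))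
          (all-cong (λ u → suc≤ᵇsuc (countᵇ isN u) (h ℕ.+ countᵇ isE u)) (inits w))

  startingWithN : ℕ → ℕ → ℕ → ℕ
  startingWithN zero L a = 0
  startingWithN (suc h) L zero = 0
  startingWithN (suc h) L (suc a) = ballotCount h L a

  ballotCount-suc : ∀ h L a → ballotCount h (suc L) a ≡ ballotCount (suc h) L a ℕ.+ startingWithN h L a
  ballotCount-suc h L a = begin
    length (filterᵇ (isBallotWord h a) (map (E ∷_) W ++ (map (N ∷_) W ++ [])))
      ≡⟨ cong length (LP.filter-++ (T? ∘ isBallotWord h a) (map (E ∷_) W) _) ⟩
    length (filterᵇ (isBallotWord h a) (map (E ∷_) W) ++ filterᵇ (isBallotWord h a) (map (N ∷_) W ++ []))
      ≡⟨ LP.length-++ (filterᵇ (isBallotWord h a) (map (E ∷_) W)) ⟩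
    length (filterᵇ (isBallotWord h a) (map (E ∷_) W)) ℕ.+ length (filterᵇ (isBallotWord h a) (map (N ∷_) W ++ []))
      ≡⟨ cong₂ ℕ._+_ startE (trans (cong (λ z → length (filterᵇ (isBallotWord h a) z)) (LP.++-identityʳ (map (N ∷_) W)))
                                   (trans (length-filterᵇ-map (isBallotWord h a) (N ∷_) W) (startN h a))) ⟩
    ballotCount (suc h) L a ℕ.+ startingWithN h L a ∎
    where
    open ≡-Reasoning
    W = words L
    startE : length (filterᵇ (isBallotWord h a) (map (E ∷_) W)) ≡ ballotCount (suc h) L a
    startE = trans (length-filterᵇ-map (isBallotWord h a) (E ∷_) W)
      (cong length (filterᵇ-congAll (All.universal (λ w → cong ((countᵇ isN w ≡ᵇ a) ∧_) (ballotFrom-E h w)) W)))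
    startN : ∀ h a → length (filterᵇ (isBallotWord h a ∘ (N ∷_)) W) ≡ startingWithN h L a
    startN zero a = cong length (filterᵇ-none (All.universal (λ w → ∧-false _) W))
      where
      ∧-false : ∀ b → b ∧ false ≡ false
      ∧-false true = refl
      ∧-false false = refl
    startN (suc h) zero = cong length (filterᵇ-none (All.universal (λ w → refl) W))
    startN (suc h) (suc a) =
      cong length (filterᵇ-congAll (All.universal (λ w → cong ((countᵇ isN w ≡ᵇ a) ∧_) (ballotFrom-N h w)) W))

  -- The reflected count C(L, a-h-1) of words violating the h-ballot condition.
  reflected : ℕ → ℕ → ℕ → ℕ
  reflected L zero h = 0
  reflected L (suc a) zero = binomial L a
  reflected L (suc a) (suc h) = reflected L a h

  reflected-≤ : ∀ L a h → a ≤ h → reflected L a h ≡ 0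
  reflected-≤ L zero h le = refl
  reflected-≤ L (suc a) (suc h) (s≤s le) = reflected-≤ L a h le

  reflected-suc : ∀ L a h → reflected (suc L) a h ≡ reflected L a h ℕ.+ reflected L a (suc h)
  reflected-suc L zero h = refl
  reflected-suc L (suc zero) zero = refl
  reflected-suc L (suc (suc a)) zero = ℕP.+-comm (binomial L a) (binomial L (suc a))
  reflected-suc L (suc a) (suc h) = reflected-suc L a h

  binomial-suc : ∀ L a → binomial (suc L) a ≡ reflected L a 0 ℕ.+ binomial L a
  binomial-suc L zero = refl
  binomial-suc L (suc a) = refl

  ballot-reflection : ∀ L h a → a ℕ.+ a ≤ L ℕ.+ h → ballotCount h L a ℕ.+ reflected L a h ≡ binomial L a
  ballot-reflection zero h zero le = refl
  ballot-reflection zero h (suc a) le = reflected-≤ zero (suc a) h (ℕP.≤-trans (ℕP.m≤m+n (suc a) (suc a)) le)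
  ballot-reflection (suc L) h a le = begin
    ballotCount h (suc L) a ℕ.+ reflected (suc L) a h
      ≡⟨ cong₂ ℕ._+_ (ballotCount-suc h L a) (reflected-suc L a h) ⟩
    (ballotCount (suc h) L a ℕ.+ startingWithN h L a) ℕ.+ (reflected L a h ℕ.+ reflected L a (suc h))
      ≡⟨ regroup (ballotCount (suc h) L a) (startingWithN h L a) (reflected L a h) (reflected L a (suc h)) ⟩
    (ballotCount (suc h) L a ℕ.+ reflected L a (suc h)) ℕ.+ (startingWithN h L a ℕ.+ reflected L a h)
      ≡⟨ cong₂ ℕ._+_ (ballot-reflection L (suc h) a (ℕP.≤-trans le (ℕP.≤-reflexive (sym (ℕP.+-suc L h)))))
                     (startingWithN-reflected h a le) ⟩
    binomial L a ℕ.+ reflected L a 0 ≡⟨ ℕP.+-comm (binomial L a) _ ⟩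
    reflected L a 0 ℕ.+ binomial L a ≡⟨ binomial-suc L a ⟨
    binomial (suc L) a ∎
    where
    open ≡-Reasoning
    open import Data.Nat.Tactic.RingSolver
    regroup : ∀ x y z w → (x ℕ.+ y) ℕ.+ (z ℕ.+ w) ≡ (x ℕ.+ w) ℕ.+ (y ℕ.+ z)
    regroup = solve-∀
    startingWithN-reflected : ∀ h a → a ℕ.+ a ≤ suc L ℕ.+ h →
      startingWithN h L a ℕ.+ reflected L a h ≡ reflected L a 0
    startingWithN-reflected zero a le = refl
    startingWithN-reflected (suc h) zero le = refl
    startingWithN-reflected (suc h) (suc a) le = ballot-reflection L h a
      (ℕ.s≤s⁻¹ (ℕ.s≤s⁻¹ (ℕP.≤-trans (ℕP.≤-reflexive (cong suc (sym (ℕP.+-suc a a))))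
                        (ℕP.≤-trans le (ℕP.≤-reflexive (cong suc (ℕP.+-suc L h)))))))

  sign : ℕ → ℤ
  sign e = (ℤ.- (+ 1)) ℤ.^ e

  gvec-1+q^ : ∀ u i → i ℕ.+ i ≤ u → gvec (1+q ^ₚ u) i ≡ + ballotCount 0 u i
  gvec-1+q^ u zero le =
    trans (coeff-1+q^ u zero) (cong +_ (sym (trans (sym (ℕP.+-identityʳ _)) (ballot-reflection u 0 0 z≤n))))
  gvec-1+q^ u (suc i) le = begin
    coeff (1+q ^ₚ u) (suc i) ℤ.- coeff (1+q ^ₚ u) i
      ≡⟨ cong₂ ℤ._-_ (coeff-1+q^ u (suc i)) (coeff-1+q^ u i) ⟩
    + binomial u (suc i) ℤ.- + binomial u i
      ≡⟨ cong (λ z → + z ℤ.- + binomial u i) (ballot-reflection u 0 (suc i) (ℕP.≤-trans le (ℕP.m≤m+n u 0))) ⟨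
    + (B ℕ.+ binomial u i) ℤ.- + binomial u i
      ≡⟨ cong (ℤ._- + binomial u i) (ℤP.pos-+ B (binomial u i)) ⟩
    (+ B ℤ.+ + binomial u i) ℤ.- + binomial u i
      ≡⟨ cancel (+ B) (+ binomial u i) ⟩
    + B ∎
    where
    open ≡-Reasoning
    B = ballotCount 0 u (suc i)
    open import Data.Integer.Tactic.RingSolver
    cancel : ∀ x y → (x ℤ.+ y) ℤ.- y ≡ x
    cancel = solve-∀

  gvec-γ : ∀ e u i → i ℕ.+ i ≤ (e ℕ.+ e) ℕ.+ u →
    gvec (γ e u) i ≡ sign e ℤ.* + (if e ≤ᵇ i then ballotCount 0 u (i ∸ e) else 0)
  gvec-γ zero u i le =
    trans (gvec-cong (*-identityˡ (1+q ^ₚ u)) i) (trans (gvec-1+q^ u i le) (sym (ℤP.*-identityˡ _)))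
  gvec-γ (suc e) u zero le =
    trans (gvec-cong (γ-sucˡ e u) zero) (trans (gvec--q*-zero (γ e u)) (sym (ℤP.*-zeroʳ (sign (suc e)))))
  gvec-γ (suc e) u (suc i) le = begin
    gvec (γ (suc e) u) (suc i)    ≡⟨ gvec-cong (γ-sucˡ e u) (suc i) ⟩
    gvec (-q *ₚ γ e u) (suc i)    ≡⟨ gvec--q*-suc (γ e u) i ⟩
    ℤ.- gvec (γ e u) i            ≡⟨ cong ℤ.-_ (gvec-γ e u i le') ⟩
    ℤ.- (sign e ℤ.* X)            ≡⟨ ℤP.-1*i≡-i _ ⟨
    ℤ.- (+ 1) ℤ.* (sign e ℤ.* X)  ≡⟨ ℤP.*-assoc (ℤ.- (+ 1)) (sign e) X ⟨
    sign (suc e) ℤ.* X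
      ≡⟨ cong (λ b → sign (suc e) ℤ.* + (if b then ballotCount 0 u (i ∸ e) else 0)) (suc≤ᵇsuc e i) ⟨
    sign (suc e) ℤ.* + (if suc e ≤ᵇ suc i then ballotCount 0 u (suc i ∸ suc e) else 0) ∎
    where
    open ≡-Reasoning
    X = + (if e ≤ᵇ i then ballotCount 0 u (i ∸ e) else 0)
    le' : i ℕ.+ i ≤ (e ℕ.+ e) ℕ.+ u
    le' = ℕ.s≤s⁻¹ (ℕ.s≤s⁻¹ (ℕP.≤-trans (ℕP.≤-reflexive (cong suc (sym (ℕP.+-suc i i))))
            (ℕP.≤-trans le (ℕP.≤-reflexive (cong (λ z → suc z ℕ.+ u) (ℕP.+-suc e e))))))

  length-ℬ : ∀ d i e → 2 ℕ.* e ≤ d →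
    length (ℬ d i e) ≡ (if e ≤ᵇ i then ballotCount 0 (d ∸ 2 ℕ.* e) (i ∸ e) else 0)
  length-ℬ d i e le with e ≤ᵇ i
  ... | false = refl
  ... | true rewrite Equivalence.to T-≡ (ℕP.≤⇒≤ᵇ le) = refl

  gvec-γ-ℬ : ∀ d e i → 2 ℕ.* e ≤ d → i ℕ.+ i ≤ d →
    gvec (γ e (d ∸ 2 ℕ.* e)) i ≡ sign e ℤ.* + length (ℬ d i e)
  gvec-γ-ℬ d e i le₁ le₂ =
    trans (gvec-γ e (d ∸ 2 ℕ.* e) i le₃) (cong (λ z → sign e ℤ.* + z) (sym (length-ℬ d i e le₁)))
    where
    le₃ : i ℕ.+ i ≤ (e ℕ.+ e) ℕ.+ (d ∸ 2 ℕ.* e)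
    le₃ = ℕP.≤-trans le₂ (ℕP.≤-reflexive (trans (sym (ℕP.m+[n∸m]≡n le₁))
            (cong (ℕ._+ (d ∸ 2 ℕ.* e)) (cong (e ℕ.+_) (ℕP.+-identityʳ e)))))

module GammaExpansion where

  open PolynomialRing
  open PolySums
  open GammaBasis
  open BallotPaths using (sign; gvec-γ-ℬ)
  open ListTools using (length-cartesianProduct)
  open import Data.Integer as ℤ using (ℤ; +_; 0ℤ)
  import Data.Integer.Properties as ℤP
  open import Data.Nat as ℕ using (ℕ; zero; suc; _∸_; _≤_; _<_; z≤n; _≤ᵇ_; _≡ᵇ_; _<ᵇ_)
  import Data.Nat.Properties as ℕP
  open import Data.List using (List; []; _∷_; map; length; filterᵇ; applyUpTo; upTo; concatMap; cartesianProduct)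
  import Data.List.Properties as LP
  open import Data.List.Relation.Unary.All as All using (All; []; _∷_)
  import Data.List.Relation.Unary.All.Properties as AllP
  open import Data.Nat.ListAction using (sum)
  open import Data.Bool as Bool using (Bool; true; false; if_then_else_)
  open import Data.Product using (_×_; _,_; proj₁; proj₂)
  open import Data.Empty using (⊥-elim)
  open import Function using (_∘_)
  open import Relation.Binary.PropositionalEquality

  sumBelow : ℕ → (ℕ → ℤ) → ℤ
  sumBelow zero h = 0ℤ
  sumBelow (suc n) h = h 0 ℤ.+ sumBelow n (h ∘ suc)

  sumℤ-applyUpTo : ∀ (g : ℕ → ℤ) f n → sumℤ (map g (applyUpTo f n)) ≡ sumBelow n (g ∘ f)
  sumℤ-applyUpTo g f zero = refl
  sumℤ-applyUpTo g f (suc n) = cong (λ z → g (f 0) ℤ.+ z) (sumℤ-applyUpTo g (f ∘ suc) n)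

  altSum≡sumBelow : ∀ i c → altSum i c ≡ sumBelow (suc i) (λ j → sign j ℤ.* + c j)
  altSum≡sumBelow i c = sumℤ-applyUpTo (λ j → sign j ℤ.* + c j) (λ j → j) (suc i)

  sumBelow-cong : ∀ {h h' : ℕ → ℤ} → (∀ j → h j ≡ h' j) → ∀ n → sumBelow n h ≡ sumBelow n h'
  sumBelow-cong e zero = refl
  sumBelow-cong e (suc n) = cong₂ ℤ._+_ (e 0) (sumBelow-cong (e ∘ suc) n)

  sumBelow-+ : ∀ (h h' : ℕ → ℤ) n → sumBelow n (λ j → h j ℤ.+ h' j) ≡ sumBelow n h ℤ.+ sumBelow n h'
  sumBelow-+ h h' zero = refl
  sumBelow-+ h h' (suc n) =
    trans (cong (λ z → (h 0 ℤ.+ h' 0) ℤ.+ z) (sumBelow-+ (h ∘ suc) (h' ∘ suc) n))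
          (interchange (h 0) (h' 0) _ _)
    where
    open import Data.Integer.Tactic.RingSolver
    interchange : ∀ a b c d → (a ℤ.+ b) ℤ.+ (c ℤ.+ d) ≡ (a ℤ.+ c) ℤ.+ (b ℤ.+ d)
    interchange = solve-∀

  sumBelow-zero : ∀ n → sumBelow n (λ _ → 0ℤ) ≡ 0ℤ
  sumBelow-zero zero = refl
  sumBelow-zero (suc n) = trans (ℤP.+-identityˡ _) (sumBelow-zero n)

  sumBelow-single : ∀ n k (a : ℕ → ℤ) →
    sumBelow n (λ j → if k ≡ᵇ j then a j else 0ℤ) ≡ (if k <ᵇ n then a k else 0ℤ)
  sumBelow-single zero k a = refl
  sumBelow-single (suc n) zero a =
    trans (cong (λ z → a 0 ℤ.+ z) (sumBelow-zero n)) (ℤP.+-identityʳ (a 0))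
  sumBelow-single (suc n) (suc k) a = trans (ℤP.+-identityˡ _) (sumBelow-single n k (a ∘ suc))

  sum-by-weight : {X : Set} (w : X → ℕ) (B : ℕ → ℕ) (i : ℕ) → (∀ j → i < j → B j ≡ 0) → (T : List X) →
    sumℤ (map (λ t → sign (w t) ℤ.* + B (w t)) T)
      ≡ altSum i (λ j → length (filterᵇ (λ t → w t ≡ᵇ j) T) ℕ.* B j)
  sum-by-weight {X} w B i B-vanishes T =
    trans (bySorting T) (sym (altSum≡sumBelow i (λ j → count T j ℕ.* B j)))
    where
    count : List X → ℕ → ℕ
    count T j = length (filterᵇ (λ t → w t ≡ᵇ j) T)
    term : List X → ℕ → ℤ
    term T j = sign j ℤ.* + (count T j ℕ.* B j)
    indicator : X → ℕ → ℤ
    indicator x j = if w x ≡ᵇ j then sign j ℤ.* + B j else 0ℤ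
    term-∷ : ∀ x T j → term (x ∷ T) j ≡ indicator x j ℤ.+ term T j
    term-∷ x T j with w x ≡ᵇ j
    ... | true = trans (cong (sign j ℤ.*_) (ℤP.pos-+ (B j) (count T j ℕ.* B j))) (ℤP.*-distribˡ-+ (sign j) (+ B j) _)
    ... | false = sym (ℤP.+-identityˡ _)
    sum-indicator : ∀ x → sumBelow (suc i) (indicator x) ≡ sign (w x) ℤ.* + B (w x)
    sum-indicator x with w x <ᵇ suc i in lt
    ... | true = trans (sumBelow-single (suc i) (w x) (λ j → sign j ℤ.* + B j))
                       (cong (λ b → if b then sign (w x) ℤ.* + B (w x) else 0ℤ) lt)
    ... | false = trans (sumBelow-single (suc i) (w x) (λ j → sign j ℤ.* + B j))
                  (trans (cong (λ b → if b then sign (w x) ℤ.* + B (w x) else 0ℤ) lt)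
                  (sym (trans (cong (λ z → sign (w x) ℤ.* + z) (B-vanishes (w x) (≮⇒> lt))) (ℤP.*-zeroʳ (sign (w x))))))
      where
      ≮⇒> : (w x <ᵇ suc i) ≡ false → i < w x
      ≮⇒> e = ℕP.≰⇒> (λ le → subst Bool.T e (ℕP.<⇒<ᵇ (ℕ.s≤s le)))
    bySorting : ∀ T → sumℤ (map (λ t → sign (w t) ℤ.* + B (w t)) T) ≡ sumBelow (suc i) (term T)
    bySorting [] = sym (trans (sumBelow-cong (λ j → ℤP.*-zeroʳ (sign j)) (suc i)) (sumBelow-zero (suc i)))
    bySorting (x ∷ T) = sym (begin
      sumBelow (suc i) (term (x ∷ T))                                 ≡⟨ sumBelow-cong (term-∷ x T) (suc i) ⟩
      sumBelow (suc i) (λ j → indicator x j ℤ.+ term T j)             ≡⟨ sumBelow-+ (indicator x) (term T) (suc i) ⟩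
      sumBelow (suc i) (indicator x) ℤ.+ sumBelow (suc i) (term T)    ≡⟨ cong₂ ℤ._+_ (sum-indicator x) (sym (bySorting T)) ⟩
      sign (w x) ℤ.* + B (w x) ℤ.+ sumℤ (map (λ t → sign (w t) ℤ.* + B (w t)) T) ∎)
      where open ≡-Reasoning

  altSum-cong : ∀ i {c c' : ℕ → ℕ} → (∀ j → c j ≡ c' j) → altSum i c ≡ altSum i c'
  altSum-cong i e = cong sumℤ (LP.map-cong (λ j → cong (λ z → sign j ℤ.* + z) (e j)) (upTo (suc i)))

  ℬ-vanishes : ∀ d i j → i < j → length (ℬ d i j) ≡ 0
  ℬ-vanishes d i j lt with j ≤ᵇ i in le
  ... | false = refl
  ... | true = ⊥-elim (ℕP.<⇒≱ lt (ℕP.≤ᵇ⇒≤ j i (subst Bool.T (sym le) _)))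

  gvec-of-γ-expansion : {X : Set} (w : X → ℕ) (T : List X) (h : Poly) (d i : ℕ) →
    h ≈ Σₚ (map (λ x → γ (w x) (d ∸ 2 ℕ.* w x)) T) →
    All (λ x → 2 ℕ.* w x ≤ d) T → i ℕ.+ i ≤ d →
    gvec h i ≡ altSum i (λ j → length (cartesianProduct (filterᵇ (λ x → w x ≡ᵇ j) T) (ℬ d i j)))
  gvec-of-γ-expansion {X} w T h d i h≈ bounded le = begin
    gvec h i                                                 ≡⟨ gvec-cong h≈ i ⟩
    gvec (Σₚ (map γw T)) i                                   ≡⟨ gvec-Σ (map γw T) i ⟩
    sumℤ (map (λ p → gvec p i) (map γw T))                   ≡⟨ cong sumℤ (sym (LP.map-∘ T)) ⟩
    sumℤ (map (λ x → gvec (γw x) i) T)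
      ≡⟨ sumℤ-congAll (All.map (λ {x} b → gvec-γ-ℬ d (w x) i b le) bounded) ⟩
    sumℤ (map (λ x → sign (w x) ℤ.* + length (ℬ d i (w x))) T)
      ≡⟨ sum-by-weight w (λ j → length (ℬ d i j)) i (ℬ-vanishes d i) T ⟩
    altSum i (λ j → length (filterᵇ (λ x → w x ≡ᵇ j) T) ℕ.* length (ℬ d i j))
      ≡⟨ altSum-cong i (λ j → sym (length-cartesianProduct (filterᵇ (λ x → w x ≡ᵇ j) T) (ℬ d i j))) ⟩
    altSum i (λ j → length (cartesianProduct (filterᵇ (λ x → w x ≡ᵇ j) T) (ℬ d i j))) ∎
    where
    open ≡-Reasoning
    γw : X → Poly
    γw x = γ (w x) (d ∸ 2 ℕ.* w x)

  γOf : ℕ → List Bool → Poly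
  γOf s x = γ (countTrue x) (s ∸ 2 ℕ.* countTrue x)

  Γ : List (List Bool) → ℕ → Poly
  Γ X s = Σₚ (map (γOf s) X)

  Fits : ℕ → List Bool → Set
  Fits s x = 2 ℕ.* countTrue x ≤ s

  -- A component of a tuple: the list of its matchings and its number of vertices.
  Component : Set
  Component = List (List Bool) × ℕ

  totalSize : List Component → ℕ
  totalSize cs = sum (map proj₂ cs)

  AllFit : List Component → Set
  AllFit cs = All (λ c → All (Fits (proj₂ c)) (proj₁ c)) cs

  γ-split : ∀ a b s D → 2 ℕ.* a ≤ s → 2 ℕ.* b ≤ D →
    γ (a ℕ.+ b) ((s ℕ.+ D) ∸ 2 ℕ.* (a ℕ.+ b)) ≈ γ a (s ∸ 2 ℕ.* a) *ₚ γ b (D ∸ 2 ℕ.* b)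
  γ-split a b s D le₁ le₂ =
    ≈-trans (≈-reflexive (cong (γ (a ℕ.+ b)) size-split)) (≈-sym (γ-* a (s ∸ 2 ℕ.* a) b (D ∸ 2 ℕ.* b)))
    where
    open import Data.Nat.Tactic.RingSolver
    regroup : ∀ a b x y → (2 ℕ.* a ℕ.+ x) ℕ.+ (2 ℕ.* b ℕ.+ y) ≡ 2 ℕ.* (a ℕ.+ b) ℕ.+ (x ℕ.+ y)
    regroup = solve-∀
    size-split : (s ℕ.+ D) ∸ 2 ℕ.* (a ℕ.+ b) ≡ (s ∸ 2 ℕ.* a) ℕ.+ (D ∸ 2 ℕ.* b)
    size-split = trans (cong (_∸ 2 ℕ.* (a ℕ.+ b))
        (trans (cong₂ ℕ._+_ (sym (ℕP.m+[n∸m]≡n le₁)) (sym (ℕP.m+[n∸m]≡n le₂))) (regroup a b _ _)))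
      (ℕP.m+n∸m≡n (2 ℕ.* (a ℕ.+ b)) _)

  tuples-fit : (cs : List Component) → AllFit cs →
    All (λ t → 2 ℕ.* totalEdges t ≤ totalSize cs) (seqs (map proj₁ cs))
  tuples-fit [] [] = z≤n ∷ []
  tuples-fit ((xs , s) ∷ cs) (fit ∷ fits) =
    AllP.concat⁺ (AllP.map⁺ (All.map (λ {x} fx → AllP.map⁺
      (All.map (λ {t} ft → add {countTrue x} {totalEdges t} fx ft) (tuples-fit cs fits))) fit))
    where
    add : ∀ {a b} → 2 ℕ.* a ≤ s → 2 ℕ.* b ≤ totalSize cs → 2 ℕ.* (a ℕ.+ b) ≤ s ℕ.+ totalSize cs
    add {a} {b} le₁ le₂ = ℕP.≤-trans (ℕP.≤-reflexive (ℕP.*-distribˡ-+ 2 a b)) (ℕP.+-mono-≤ le₁ le₂)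

  Γ-tuples : (cs : List Component) → AllFit cs →
    Σₚ (map (λ t → γ (totalEdges t) (totalSize cs ∸ 2 ℕ.* totalEdges t)) (seqs (map proj₁ cs)))
      ≈ prodP (map (λ c → Γ (proj₁ c) (proj₂ c)) cs)
  Γ-tuples [] [] = +-identityʳ onePoly
  Γ-tuples ((xs , s) ∷ cs) (fit ∷ fits) = begin
    Σₚ (map (wt (s ℕ.+ D)) (concatMap (λ x → map (x ∷_) S) xs))
      ≈⟨ Σₚ-concatMap (wt (s ℕ.+ D)) (λ x → map (x ∷_) S) xs ⟩
    Σₚ (map (λ x → Σₚ (map (wt (s ℕ.+ D)) (map (x ∷_) S))) xs) ≈⟨ Σₚ-congAll (All.map with-first fit) ⟩
    Σₚ (map (λ x → γOf s x *ₚ prodP rest) xs)                  ≈⟨ Σₚ-*ʳ (γOf s) xs (prodP rest) ⟨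
    Γ xs s *ₚ prodP rest ∎
    where
    open ≈-Reasoning
    D = totalSize cs
    S = seqs (map proj₁ cs)
    rest = map (λ c → Γ (proj₁ c) (proj₂ c)) cs
    wt : ℕ → List (List Bool) → Poly
    wt D t = γ (totalEdges t) (D ∸ 2 ℕ.* totalEdges t)
    with-first : ∀ {x} → Fits s x → Σₚ (map (wt (s ℕ.+ D)) (map (x ∷_) S)) ≈ γOf s x *ₚ prodP rest
    with-first {x} fx = begin
      Σₚ (map (wt (s ℕ.+ D)) (map (x ∷_) S)) ≡⟨ Σₚ-map (wt (s ℕ.+ D)) (x ∷_) S ⟩
      Σₚ (map (λ t → wt (s ℕ.+ D) (x ∷ t)) S)
        ≈⟨ Σₚ-congAll (All.map (λ {t} ft → γ-split (countTrue x) (totalEdges t) s D fx ft) (tuples-fit cs fits)) ⟩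
      Σₚ (map (λ t → γOf s x *ₚ wt D t) S) ≈⟨ Σₚ-*ˡ (γOf s x) (wt D) S ⟨
      γOf s x *ₚ Σₚ (map (wt D) S)         ≈⟨ *-congʳ (γOf s x) (Γ-tuples cs fits) ⟩
      γOf s x *ₚ prodP rest ∎

  gvec-of-Γ-product : (cs : List Component) (h : Poly) (d i : ℕ) → AllFit cs →
    h ≈ prodP (map (λ c → Γ (proj₁ c) (proj₂ c)) cs) → totalSize cs ≡ d → i ℕ.+ i ≤ d →
    gvec h i ≡ altSum i (λ j → length (cartesianProduct
                 (filterᵇ (λ t → totalEdges t ≡ᵇ j) (seqs (map proj₁ cs))) (ℬ d i j)))
  gvec-of-Γ-product cs h d i fits h≈ refl le =
    gvec-of-γ-expansion totalEdges (seqs (map proj₁ cs)) h d i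
      (≈-trans h≈ (≈-sym (Γ-tuples cs fits))) (tuples-fit cs fits) le

module QIntegers where

  open PolynomialRing
  open GammaBasis
  open import Data.Nat as ℕ using (ℕ; zero; suc)
  open import Data.List using ([])
  open import Relation.Binary.PropositionalEquality using (refl)
  open ≈-Reasoning
  open import Tactic.RingSolver.NonReflective polyAlmostRing

  qint-suc : ∀ n → qint (suc n) ≈ onePoly +ₚ q *ₚ qint n
  qint-suc n = ≈-sym (+-cong (≈-refl {onePoly}) (q*≈shift (qint n)))

  qint-rec : ∀ k → 1+q *ₚ qint (suc k) +ₚ -q *ₚ qint k ≈ qint (suc (suc k))
  qint-rec k = begin
    1+q *ₚ qint (suc k) +ₚ -q *ₚ A           ≈⟨ +-cong (*-cong 1+q≈1+q (qint-suc k)) (≈-refl { -q *ₚ A}) ⟩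
    (one +ₚ q) *ₚ (one +ₚ q *ₚ A) +ₚ -q *ₚ A
      ≈⟨ solve 3 (λ Q Q' A → (((Κ one ⊕ Q) ⊗ (Κ one ⊕ Q ⊗ A)) ⊕ Q' ⊗ A)
                              ⊜ ((Κ one ⊕ Q ⊗ (Κ one ⊕ Q ⊗ A)) ⊕ (Q ⊕ Q') ⊗ A)) ≈-refl q -q A ⟩
    (one +ₚ q *ₚ (one +ₚ q *ₚ A)) +ₚ (q +ₚ -q) *ₚ A
      ≈⟨ +-cong (≈-refl {one +ₚ q *ₚ (one +ₚ q *ₚ A)}) (*-zero-cong (q +ₚ -q) A q+-q≈0) ⟩
    (one +ₚ q *ₚ (one +ₚ q *ₚ A)) +ₚ []            ≈⟨ +-identityʳ _ ⟩
    one +ₚ q *ₚ (one +ₚ q *ₚ A)                    ≈⟨ +-cong (≈-refl {one}) (*-congʳ q (qint-suc k)) ⟨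
    one +ₚ q *ₚ qint (suc k)                     ≈⟨ qint-suc (suc k) ⟨
    qint (suc (suc k)) ∎
    where
    one A : Poly
    one = onePoly
    A = qint k

  qint-cycle : ∀ k → qint (suc (suc k)) +ₚ -q *ₚ qint k ≈ onePoly +ₚ qpow (suc k)
  qint-cycle zero = coeffwise λ { zero → refl ; (suc zero) → refl ; (suc (suc t)) → refl }
  qint-cycle (suc k) = begin
    qint (suc (suc (suc k))) +ₚ -q *ₚ qint (suc k) ≈⟨ +-cong (qint-suc (suc (suc k))) (*-congʳ -q (qint-suc k)) ⟩
    (one +ₚ q *ₚ A) +ₚ -q *ₚ (one +ₚ q *ₚ B)
      ≈⟨ solve 4 (λ Q Q' A B → ((Κ one ⊕ Q ⊗ A) ⊕ Q' ⊗ (Κ one ⊕ Q ⊗ B))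
                                ⊜ ((Κ one ⊕ Q') ⊕ Q ⊗ (A ⊕ Q' ⊗ B)))
               ≈-refl q -q A B ⟩
    (one +ₚ -q) +ₚ q *ₚ (A +ₚ -q *ₚ B)           ≈⟨ +-cong (≈-refl {one +ₚ -q}) (*-congʳ q (qint-cycle k)) ⟩
    (one +ₚ -q) +ₚ q *ₚ (one +ₚ qpow (suc k))
      ≈⟨ solve 3 (λ Q Q' P → ((Κ one ⊕ Q') ⊕ Q ⊗ (Κ one ⊕ P)) ⊜ ((Κ one ⊕ Q ⊗ P) ⊕ (Q ⊕ Q')))
               ≈-refl q -q (qpow (suc k)) ⟩
    (one +ₚ q *ₚ qpow (suc k)) +ₚ (q +ₚ -q)     ≈⟨ +-cong (+-cong (≈-refl {one}) (q*≈shift (qpow (suc k)))) q+-q≈0 ⟩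
    (one +ₚ qpow (suc (suc k))) +ₚ []            ≈⟨ +-identityʳ _ ⟩
    one +ₚ qpow (suc (suc k)) ∎
    where
    one A B : Poly
    one = onePoly
    A = qint (suc (suc k))
    B = qint k

  qint-product : ∀ a b → qint (suc a) *ₚ qint (suc b) +ₚ -q *ₚ (qint a *ₚ qint b) ≈ qint (suc (a ℕ.+ b))
  qint-product zero b = ≈-trans (+-cong (*-identityˡ (qint (suc b))) (*-zeroʳ -q)) (+-identityʳ _)
  qint-product (suc a) b = begin
    qint (suc (suc a)) *ₚ B₁ +ₚ -q *ₚ (qint (suc a) *ₚ B₀)
      ≈⟨ +-cong (*-congˡ B₁ (qint-suc (suc a))) (*-congʳ -q (*-congˡ B₀ (qint-suc a))) ⟩
    (one +ₚ q *ₚ A₁) *ₚ B₁ +ₚ -q *ₚ ((one +ₚ q *ₚ A₀) *ₚ B₀)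
      ≈⟨ solve 6 (λ Q Q' A₁ A₀ B₁ B₀ → (((Κ one ⊕ Q ⊗ A₁) ⊗ B₁) ⊕ Q' ⊗ ((Κ one ⊕ Q ⊗ A₀) ⊗ B₀))
                                       ⊜ ((B₁ ⊕ Q' ⊗ B₀) ⊕ Q ⊗ (A₁ ⊗ B₁ ⊕ Q' ⊗ (A₀ ⊗ B₀))))
               ≈-refl q -q A₁ A₀ B₁ B₀ ⟩
    (B₁ +ₚ -q *ₚ B₀) +ₚ q *ₚ (A₁ *ₚ B₁ +ₚ -q *ₚ (A₀ *ₚ B₀))
      ≈⟨ +-cong (+-cong (qint-suc b) (≈-refl { -q *ₚ B₀})) (*-congʳ q (qint-product a b)) ⟩
    ((one +ₚ q *ₚ B₀) +ₚ -q *ₚ B₀) +ₚ q *ₚ C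
      ≈⟨ solve 4 (λ Q Q' B₀ C → (((Κ one ⊕ Q ⊗ B₀) ⊕ Q' ⊗ B₀) ⊕ Q ⊗ C)
                                 ⊜ ((Κ one ⊕ Q ⊗ C) ⊕ (Q ⊕ Q') ⊗ B₀))
               ≈-refl q -q B₀ C ⟩
    (one +ₚ q *ₚ C) +ₚ (q +ₚ -q) *ₚ B₀
      ≈⟨ +-cong (≈-sym (qint-suc (suc (a ℕ.+ b)))) (*-zero-cong (q +ₚ -q) B₀ q+-q≈0) ⟩
    qint (suc (suc (a ℕ.+ b))) +ₚ [] ≈⟨ +-identityʳ _ ⟩
    qint (suc (suc (a ℕ.+ b))) ∎
    where
    one A₁ A₀ B₁ B₀ C : Poly
    one = onePoly
    A₁ = qint (suc a)
    A₀ = qint a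
    B₁ = qint (suc b)
    B₀ = qint b
    C = qint (suc (a ℕ.+ b))

-- Matchings of a path, possibly restricted to an admissible set of edges,
-- satisfy the recursion "the first edge is unused, or it is used and the
-- second vertex is covered"; hence their γ-generating function is [m+1].
module PathMatchings where

  open PolynomialRing
  open PolySums
  open GammaBasis
  open QIntegers
  open ListTools
  open GammaExpansion using (γOf; Γ; Fits)
  open import Data.Nat as ℕ using (ℕ; zero; suc; _∸_; _≤_; z≤n; s≤s)
  import Data.Nat.Properties as ℕP
  open import Data.List using (List; []; _∷_; _++_; map; length; filterᵇ)
  import Data.List.Properties as LP
  open import Data.List.Relation.Unary.All as All using (All; []; _∷_)
  import Data.List.Relation.Unary.All.Properties as AllP
  open import Data.Bool using (Bool; true; false; _∧_; T?)
  open import Data.Bool.ListAction using (all)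
  open import Data.Fin using (zero; suc; fromℕ)
  open import Data.Product using (_,_)
  open import Function using (_∘_)
  open import Relation.Binary.PropositionalEquality

  allBools-suc : ∀ L → allBools (suc L) ≡ map (false ∷_) (allBools L) ++ map (true ∷_) (allBools L)
  allBools-suc L = cong (map (false ∷_) (allBools L) ++_) (LP.++-identityʳ _)

  filterᵇ-allBools-suc : (P : List Bool → Bool) (L : ℕ) →
    filterᵇ P (allBools (suc L))
      ≡ map (false ∷_) (filterᵇ (P ∘ (false ∷_)) (allBools L)) ++ map (true ∷_) (filterᵇ (P ∘ (true ∷_)) (allBools L))
  filterᵇ-allBools-suc P L = begin
    filterᵇ P (allBools (suc L))                              ≡⟨ cong (filterᵇ P) (allBools-suc L) ⟩
    filterᵇ P (map (false ∷_) A ++ map (true ∷_) A)           ≡⟨ LP.filter-++ (T? ∘ P) (map (false ∷_) A) _ ⟩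
    filterᵇ P (map (false ∷_) A) ++ filterᵇ P (map (true ∷_) A) ≡⟨ cong₂ _++_ (filterᵇ-map P (false ∷_) A) (filterᵇ-map P (true ∷_) A) ⟩
    map (false ∷_) (filterᵇ (P ∘ (false ∷_)) A) ++ map (true ∷_) (filterᵇ (P ∘ (true ∷_)) A) ∎
    where
    open ≡-Reasoning
    A = allBools L

  selected-map : ∀ {m n} (f : Edge m → Edge n) (Es : List (Edge m)) s → selected (map f Es) s ≡ map f (selected Es s)
  selected-map f [] s = refl
  selected-map f (x ∷ Es) [] = refl
  selected-map f (x ∷ Es) (true ∷ s) = cong (f x ∷_) (selected-map f Es s)
  selected-map f (x ∷ Es) (false ∷ s) = selected-map f Es s

  isMatching-shift : ∀ {m} (xs : List (Edge m)) → isMatchingᵇ (map shiftE xs) ≡ isMatchingᵇ xs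
  isMatching-shift [] = refl
  isMatching-shift (e ∷ xs) =
    cong₂ (λ a b → nonLoopᵇ e ∧ a ∧ b) (all-map (disjointᵇ (shiftE e)) shiftE xs) (isMatching-shift xs)

  disjoint-from-first : ∀ {m} (xs : List (Edge m)) →
    all (disjointᵇ (zero , suc zero)) (map shiftE (map shiftE xs)) ≡ true
  disjoint-from-first [] = refl
  disjoint-from-first (x ∷ xs) = disjoint-from-first xs

  record EdgeFilter : Set where
    field
      allowed : (m : ℕ) → Edge m → Bool
      allowed-shift : ∀ m (e : Edge m) → allowed (suc m) (shiftE e) ≡ allowed m e
      allowed-first : ∀ m → allowed (suc (suc (suc m))) (zero , suc zero) ≡ true

  module Restricted (F : EdgeFilter) where
    open EdgeFilter F

    admissible : ∀ m → List (Edge m) → Bool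
    admissible m xs = isMatchingᵇ xs ∧ all (allowed m) xs

    admissible-shift : ∀ m (xs : List (Edge m)) → admissible (suc m) (map shiftE xs) ≡ admissible m xs
    admissible-shift m xs = cong₂ _∧_ (isMatching-shift xs)
      (trans (all-map (allowed (suc m)) shiftE xs) (all-cong (allowed-shift m) xs))

    restrictedMatchings : ℕ → List (List Bool)
    restrictedMatchings m =
      filterᵇ (λ s → admissible m (selected (pathEdges m) s)) (allBools (length (pathEdges m)))

    admissible-first-used : ∀ m s →
      admissible (suc (suc (suc m))) (selected (pathEdges (suc (suc (suc m)))) (true ∷ false ∷ s))
        ≡ admissible (suc m) (selected (pathEdges (suc m)) s)
    admissible-first-used m s
      rewrite selected-map shiftE (map shiftE (pathEdges (suc m))) s | selected-map shiftE (pathEdges (suc m)) s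
            | disjoint-from-first (selected (pathEdges (suc m)) s)
            | allowed-first m
            | admissible-shift (suc (suc m)) (map shiftE (selected (pathEdges (suc m)) s))
            | admissible-shift (suc m) (selected (pathEdges (suc m)) s) = refl

    restricted-rec : ∀ m → restrictedMatchings (suc (suc (suc m)))
      ≡ map (false ∷_) (restrictedMatchings (suc (suc m))) ++ map (λ s → true ∷ false ∷ s) (restrictedMatchings (suc m))
    restricted-rec m = begin
      filterᵇ P (allBools (suc (length (map shiftE E₂))))
        ≡⟨ cong (λ L → filterᵇ P (allBools (suc L))) (LP.length-map shiftE E₂) ⟩
      filterᵇ P (allBools (suc (length E₂)))
        ≡⟨ filterᵇ-allBools-suc P (length E₂) ⟩
      map (false ∷_) (filterᵇ (P ∘ (false ∷_)) (allBools (length E₂))) ++ map (true ∷_) (filterᵇ (P ∘ (true ∷_)) (allBools (length E₂)))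
        ≡⟨ cong₂ (λ X Y → map (false ∷_) X ++ map (true ∷_) Y) first-unused first-used ⟩
      map (false ∷_) (restrictedMatchings (suc (suc m))) ++ map (true ∷_) (map (false ∷_) (restrictedMatchings (suc m)))
        ≡⟨ cong (map (false ∷_) (restrictedMatchings (suc (suc m))) ++_) (sym (LP.map-∘ (restrictedMatchings (suc m)))) ⟩
      map (false ∷_) (restrictedMatchings (suc (suc m))) ++ map (λ s → true ∷ false ∷ s) (restrictedMatchings (suc m)) ∎
      where
      open ≡-Reasoning
      E₁ = pathEdges (suc m)
      E₂ = pathEdges (suc (suc m))
      P : List Bool → Bool
      P s = admissible (suc (suc (suc m))) (selected (pathEdges (suc (suc (suc m)))) s)
      first-unused : filterᵇ (P ∘ (false ∷_)) (allBools (length E₂)) ≡ restrictedMatchings (suc (suc m))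
      first-unused = filterᵇ-congAll (All.universal (λ s →
        trans (cong (admissible (suc (suc (suc m)))) (selected-map shiftE E₂ s))
              (admissible-shift (suc (suc m)) (selected E₂ s))) (allBools (length E₂)))
      first-used : filterᵇ (P ∘ (true ∷_)) (allBools (length E₂)) ≡ map (false ∷_) (restrictedMatchings (suc m))
      first-used = begin
        filterᵇ (P ∘ (true ∷_)) (allBools (suc (length (map shiftE E₁))))
          ≡⟨ cong (λ L → filterᵇ (P ∘ (true ∷_)) (allBools (suc L))) (LP.length-map shiftE E₁) ⟩
        filterᵇ (P ∘ (true ∷_)) (allBools (suc (length E₁)))
          ≡⟨ filterᵇ-allBools-suc (P ∘ (true ∷_)) (length E₁) ⟩
        map (false ∷_) (filterᵇ (P ∘ (true ∷_) ∘ (false ∷_)) (allBools (length E₁)))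
          ++ map (true ∷_) (filterᵇ (P ∘ (true ∷_) ∘ (true ∷_)) (allBools (length E₁)))
          ≡⟨ cong₂ (λ X Y → map (false ∷_) X ++ map (true ∷_) Y)
                   (filterᵇ-congAll (All.universal (admissible-first-used m) (allBools (length E₁))))
                   (filterᵇ-none (All.universal (λ _ → refl) (allBools (length E₁)))) ⟩
        map (false ∷_) (restrictedMatchings (suc m)) ++ []
          ≡⟨ LP.++-identityʳ _ ⟩
        map (false ∷_) (restrictedMatchings (suc m)) ∎

  allEdges : EdgeFilter
  allEdges = record { allowed = λ m e → true ; allowed-shift = λ m e → refl ; allowed-first = λ m → refl }

  -- Edges of the path on m+1 vertices avoiding its last vertex m; shifted to
  -- vertices 1..m+1 of the (m+2)-cycle, this says: disjoint from the closing
  -- edge {m+1, 0}.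
  avoidingLast : EdgeFilter
  avoidingLast = record { allowed = avoidsLast ; allowed-shift = avoidsLast-shift ; allowed-first = λ m → refl }
    where
    avoidsLast : (m : ℕ) → Edge m → Bool
    avoidsLast zero e = true
    avoidsLast (suc m) e = disjointᵇ (shiftE e) (fromℕ (suc m) , zero)
    avoidsLast-shift : ∀ m (e : Edge m) → avoidsLast (suc m) (shiftE e) ≡ avoidsLast m e
    avoidsLast-shift zero (() , _)
    avoidsLast-shift (suc m) (a , b) = refl

  module AllEdges = Restricted allEdges
  module AvoidingLast = Restricted avoidingLast

  avoidingLastMatchings : ℕ → List (List Bool)
  avoidingLastMatchings = AvoidingLast.restrictedMatchings

  pathMatchings-unrestricted : ∀ m → pathMatchings m ≡ AllEdges.restrictedMatchings m
  pathMatchings-unrestricted m =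
    filterᵇ-congAll (All.universal (λ s → sym (∧-all-true _ (selected (pathEdges m) s))) (allBools (length (pathEdges m))))
    where
    ∧-all-true : ∀ b (xs : List (Edge m)) → b ∧ all (λ _ → true) xs ≡ b
    ∧-all-true true [] = refl
    ∧-all-true false [] = refl
    ∧-all-true b (x ∷ xs) = ∧-all-true b xs

  pathMatchings-rec : ∀ m → pathMatchings (suc (suc (suc m)))
    ≡ map (false ∷_) (pathMatchings (suc (suc m))) ++ map (λ s → true ∷ false ∷ s) (pathMatchings (suc m))
  pathMatchings-rec m
    rewrite pathMatchings-unrestricted (suc (suc (suc m))) | pathMatchings-unrestricted (suc (suc m))
          | pathMatchings-unrestricted (suc m) = AllEdges.restricted-rec m

  extend : List (List Bool) → List (List Bool) → List (List Bool)
  extend X Y = map (false ∷_) X ++ map (λ s → true ∷ false ∷ s) Y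

  2*suc : ∀ c → 2 ℕ.* suc c ≡ suc (suc (2 ℕ.* c))
  2*suc c = ℕP.*-suc 2 c

  fits-extend : ∀ {s} X Y → All (Fits (suc s)) X → All (Fits s) Y → All (Fits (suc (suc s))) (extend X Y)
  fits-extend X Y fitX fitY = AllP.++⁺ (AllP.map⁺ (All.map ℕP.m≤n⇒m≤1+n fitX))
    (AllP.map⁺ (All.map (λ {y} f → ℕP.≤-trans (ℕP.≤-reflexive (2*suc (countTrue y))) (s≤s (s≤s f))) fitY))

  path-fits : ∀ m → All (Fits m) (pathMatchings m)
  path-fits zero = z≤n ∷ []
  path-fits (suc zero) = z≤n ∷ []
  path-fits (suc (suc zero)) = z≤n ∷ s≤s (s≤s z≤n) ∷ []
  path-fits (suc (suc (suc m))) = subst (All (Fits (suc (suc (suc m))))) (sym (pathMatchings-rec m))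
    (fits-extend _ _ (path-fits (suc (suc m))) (path-fits (suc m)))

  avoidingLast-fits : ∀ m → All (Fits m) (avoidingLastMatchings (suc m))
  avoidingLast-fits zero = z≤n ∷ []
  avoidingLast-fits (suc zero) = z≤n ∷ []
  avoidingLast-fits (suc (suc m)) = subst (All (Fits (suc (suc m)))) (sym (AvoidingLast.restricted-rec m))
    (fits-extend _ _ (avoidingLast-fits (suc m)) (avoidingLast-fits m))

  Γ-++ : ∀ X Y s → Γ (X ++ Y) s ≈ Γ X s +ₚ Γ Y s
  Γ-++ X Y s = ≈-trans (≈-reflexive (cong Σₚ (LP.map-++ (γOf s) X Y))) (Σₚ-++ (map (γOf s) X) (map (γOf s) Y))

  Γ-extend : ∀ X Y s → All (Fits (suc s)) X →
    Γ (extend X Y) (suc (suc s)) ≈ 1+q *ₚ Γ X (suc s) +ₚ -q *ₚ Γ Y s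
  Γ-extend X Y s fitX = ≈-trans (Γ-++ (map (false ∷_) X) (map (λ y → true ∷ false ∷ y) Y) (suc (suc s)))
    (+-cong first-unused first-used)
    where
    open ≈-Reasoning
    first-unused : Γ (map (false ∷_) X) (suc (suc s)) ≈ 1+q *ₚ Γ X (suc s)
    first-unused = begin
      Σₚ (map (γOf (suc (suc s))) (map (false ∷_) X)) ≡⟨ Σₚ-map (γOf (suc (suc s))) (false ∷_) X ⟩
      Σₚ (map (λ x → γOf (suc (suc s)) (false ∷ x)) X)
        ≈⟨ Σₚ-congAll (All.map (λ {x} f → ≈-trans (≈-reflexive (cong (γ (countTrue x)) (ℕP.+-∸-assoc 1 f)))
                                                   (γ-sucʳ (countTrue x) (suc s ∸ 2 ℕ.* countTrue x))) fitX) ⟩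
      Σₚ (map (λ x → 1+q *ₚ γOf (suc s) x) X) ≈⟨ Σₚ-*ˡ 1+q (γOf (suc s)) X ⟨
      1+q *ₚ Γ X (suc s) ∎
    first-used : Γ (map (λ y → true ∷ false ∷ y) Y) (suc (suc s)) ≈ -q *ₚ Γ Y s
    first-used = begin
      Σₚ (map (γOf (suc (suc s))) (map (λ y → true ∷ false ∷ y) Y)) ≡⟨ Σₚ-map (γOf (suc (suc s))) (λ y → true ∷ false ∷ y) Y ⟩
      Σₚ (map (λ y → γOf (suc (suc s)) (true ∷ false ∷ y)) Y)
        ≈⟨ Σₚ-cong Y (λ y → ≈-trans (≈-reflexive (cong (λ z → γ (suc (countTrue y)) (suc (suc s) ∸ z)) (2*suc (countTrue y))))
                                     (γ-sucˡ (countTrue y) (s ∸ 2 ℕ.* countTrue y))) ⟩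
      Σₚ (map (λ y → -q *ₚ γOf s y) Y) ≈⟨ Σₚ-*ˡ -q (γOf s) Y ⟨
      -q *ₚ Γ Y s ∎

  Γ-path : ∀ m → Γ (pathMatchings m) m ≈ qint (suc m)
  Γ-path zero = coeffwise λ { zero → refl ; (suc t) → refl }
  Γ-path (suc zero) = coeffwise λ { zero → refl ; (suc zero) → refl ; (suc (suc t)) → refl }
  Γ-path (suc (suc zero)) =
    coeffwise λ { zero → refl ; (suc zero) → refl ; (suc (suc zero)) → refl ; (suc (suc (suc t))) → refl }
  Γ-path (suc (suc (suc m))) =
    ≈-trans (≈-reflexive (cong (λ X → Γ X (suc (suc (suc m)))) (pathMatchings-rec m)))
    (≈-trans (Γ-extend _ _ (suc m) (path-fits (suc (suc m))))
    (≈-trans (+-cong (*-congʳ 1+q (Γ-path (suc (suc m)))) (*-congʳ -q (Γ-path (suc m)))) (qint-rec (suc (suc m)))))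

  Γ-avoidingLast : ∀ m → Γ (avoidingLastMatchings (suc m)) m ≈ qint (suc m)
  Γ-avoidingLast zero = coeffwise λ { zero → refl ; (suc t) → refl }
  Γ-avoidingLast (suc zero) = coeffwise λ { zero → refl ; (suc zero) → refl ; (suc (suc t)) → refl }
  Γ-avoidingLast (suc (suc m)) =
    ≈-trans (≈-reflexive (cong (λ X → Γ X (suc (suc m))) (AvoidingLast.restricted-rec m)))
    (≈-trans (Γ-extend _ _ m (avoidingLast-fits (suc m)))
    (≈-trans (+-cong (*-congʳ 1+q (Γ-avoidingLast (suc m))) (*-congʳ -q (Γ-avoidingLast m))) (qint-rec (suc m))))

-- Matchings of the m-cycle: either the closing edge {m-1,0} is unused (a
-- matching of the path), or it is used and the rest is a matching of the path
-- on vertices 1..m-1 avoiding its last vertex.  Hence Γ = [m+1] - q[m-1] = 1 + q^m.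
module CycleMatchings where

  open PolynomialRing
  open PolySums
  open GammaBasis
  open QIntegers
  open ListTools
  open GammaExpansion using (γOf; Γ; Fits)
  open PathMatchings
  open import Data.Nat as ℕ using (ℕ; zero; suc; _∸_; _≤_; z≤n; s≤s)
  import Data.Nat.Properties as ℕP
  open import Data.List using (List; []; _∷_; [_]; _++_; _∷ʳ_; map; length; filterᵇ)
  import Data.List.Properties as LP
  open import Data.List.Relation.Unary.All as All using (All; []; _∷_)
  import Data.List.Relation.Unary.All.Properties as AllP
  open import Data.List.Relation.Binary.Permutation.Propositional as Perm using (_↭_; ↭-sym)
  import Data.List.Relation.Binary.Permutation.Propositional.Properties as PermP
  open import Data.Bool using (Bool; true; false; _∧_; T?)
  open import Data.Bool.ListAction using (all)
  open import Data.Bool.Solver using (module ∨-∧-Solver)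
  open import Data.Fin using (zero; suc; fromℕ)
  open import Data.Product using (_,_)
  open import Function using (_∘_)
  open import Relation.Binary.PropositionalEquality hiding ([_])

  allBools-length : ∀ L → All (λ s → length s ≡ L) (allBools L)
  allBools-length zero = refl ∷ []
  allBools-length (suc L) rewrite allBools-suc L =
    AllP.++⁺ (AllP.map⁺ (All.map (cong suc) (allBools-length L))) (AllP.map⁺ (All.map (cong suc) (allBools-length L)))

  allBools-snoc : ∀ L → allBools (suc L) ↭ map (_∷ʳ false) (allBools L) ++ map (_∷ʳ true) (allBools L)
  allBools-snoc zero = Perm.refl
  allBools-snoc (suc L) = begin
    allBools (suc (suc L)) ≡⟨ allBools-suc (suc L) ⟩
    map (false ∷_) A ++ map (true ∷_) A
      ↭⟨ PermP.++⁺ (PermP.map⁺ (false ∷_) (allBools-snoc L)) (PermP.map⁺ (true ∷_) (allBools-snoc L)) ⟩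
    map (false ∷_) (Bf ++ Bt) ++ map (true ∷_) (Bf ++ Bt)
      ≡⟨ cong₂ _++_ (LP.map-++ (false ∷_) Bf Bt) (LP.map-++ (true ∷_) Bf Bt) ⟩
    (a ++ b) ++ (c ++ d) ↭⟨ middle-swap a b c d ⟩
    (a ++ c) ++ (b ++ d)
      ≡⟨ cong₂ _++_ (cong₂ _++_ (cons-snoc false false) (cons-snoc true false))
                    (cong₂ _++_ (cons-snoc false true) (cons-snoc true true)) ⟩
    (map (_∷ʳ false) (map (false ∷_) B) ++ map (_∷ʳ false) (map (true ∷_) B))
      ++ (map (_∷ʳ true) (map (false ∷_) B) ++ map (_∷ʳ true) (map (true ∷_) B))
      ≡⟨ cong₂ _++_ (LP.map-++ (_∷ʳ false) (map (false ∷_) B) _) (LP.map-++ (_∷ʳ true) (map (false ∷_) B) _) ⟨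
    map (_∷ʳ false) (map (false ∷_) B ++ map (true ∷_) B) ++ map (_∷ʳ true) (map (false ∷_) B ++ map (true ∷_) B)
      ≡⟨ cong₂ (λ u v → map (_∷ʳ false) u ++ map (_∷ʳ true) v) (allBools-suc L) (allBools-suc L) ⟨
    map (_∷ʳ false) (allBools (suc L)) ++ map (_∷ʳ true) (allBools (suc L)) ∎
    where
    open Perm.PermutationReasoning
    A = allBools (suc L)
    B = allBools L
    Bf = map (_∷ʳ false) B
    Bt = map (_∷ʳ true) B
    a = map (false ∷_) Bf
    b = map (false ∷_) Bt
    c = map (true ∷_) Bf
    d = map (true ∷_) Bt
    cons-snoc : ∀ x y → map (x ∷_) (map (_∷ʳ y) B) ≡ map (_∷ʳ y) (map (x ∷_) B)
    cons-snoc x y = trans (sym (LP.map-∘ B)) (LP.map-∘ B)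
    middle-swap : ∀ (a b c d : List (List Bool)) → (a ++ b) ++ (c ++ d) ↭ (a ++ c) ++ (b ++ d)
    middle-swap a b c d = begin
      (a ++ b) ++ (c ++ d) ≡⟨ LP.++-assoc a b (c ++ d) ⟩
      a ++ (b ++ (c ++ d)) ↭⟨ PermP.++⁺ˡ a (PermP.shifts b c) ⟩
      a ++ (c ++ (b ++ d)) ≡⟨ LP.++-assoc a c (b ++ d) ⟨
      (a ++ c) ++ (b ++ d) ∎

  selected-snoc : ∀ {m} (Es : List (Edge m)) (c : Edge m) (s : List Bool) (b : Bool) → length s ≡ length Es →
    selected (Es ∷ʳ c) (s ∷ʳ b) ≡ selected Es s ++ selected [ c ] [ b ]
  selected-snoc [] c [] b e = refl
  selected-snoc (x ∷ Es) c (true ∷ s) b e = cong (x ∷_) (selected-snoc Es c s b (ℕP.suc-injective e))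
  selected-snoc (x ∷ Es) c (false ∷ s) b e = selected-snoc Es c s b (ℕP.suc-injective e)

  isMatching-snoc : ∀ {m} (xs : List (Edge m)) (c : Edge m) →
    isMatchingᵇ (xs ∷ʳ c) ≡ all (λ e → disjointᵇ e c) xs ∧ (isMatchingᵇ xs ∧ nonLoopᵇ c)
  isMatching-snoc [] c = ∧-identityʳ (nonLoopᵇ c)
    where open import Data.Bool.Properties using (∧-identityʳ)
  isMatching-snoc (e ∷ xs) c rewrite all-++ (disjointᵇ e) xs [ c ] | isMatching-snoc xs c =
    regroup (nonLoopᵇ e) (all (disjointᵇ e) xs) (disjointᵇ e c) (all (λ e → disjointᵇ e c) xs) (isMatchingᵇ xs) (nonLoopᵇ c)
    where
    open ∨-∧-Solver
    regroup : ∀ ne D de A I n → ne ∧ ((D ∧ (de ∧ true)) ∧ (A ∧ (I ∧ n))) ≡ (de ∧ A) ∧ ((ne ∧ (D ∧ I)) ∧ n)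
    regroup = solve 6 (λ ne D de A I n → ne :* ((D :* (de :* con true)) :* (A :* (I :* n)))
                                       := (de :* A) :* ((ne :* (D :* I)) :* n)) refl

  countTrue-snoc-false : ∀ s → countTrue (s ∷ʳ false) ≡ countTrue s
  countTrue-snoc-false [] = refl
  countTrue-snoc-false (true ∷ s) = cong suc (countTrue-snoc-false s)
  countTrue-snoc-false (false ∷ s) = countTrue-snoc-false s

  countTrue-snoc-true : ∀ s → countTrue (s ∷ʳ true) ≡ suc (countTrue s)
  countTrue-snoc-true [] = refl
  countTrue-snoc-true (true ∷ s) = cong suc (countTrue-snoc-true s)
  countTrue-snoc-true (false ∷ s) = countTrue-snoc-true s

  module Cycle (k : ℕ) where

    Es E' : List (Edge (suc (suc (suc k))))
    Es = pathEdges (suc (suc (suc k)))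
    E' = map shiftE (pathEdges (suc (suc k)))

    c : Edge (suc (suc (suc k)))
    c = (fromℕ (suc (suc k)) , zero)

    isCycleMatching : List Bool → Bool
    isCycleMatching s = isMatchingᵇ (selected (Es ∷ʳ c) s)

    closing-unused : filterᵇ (isCycleMatching ∘ (_∷ʳ false)) (allBools (length Es)) ≡ pathMatchings (suc (suc (suc k)))
    closing-unused = filterᵇ-congAll (All.map (λ {s} e →
      cong isMatchingᵇ (trans (selected-snoc Es c s false e) (LP.++-identityʳ (selected Es s)))) (allBools-length (length Es)))

    excluded : ∀ s → length s ≡ length (pathEdges (suc (suc k))) → isCycleMatching ((true ∷ s) ∷ʳ true) ≡ false
    excluded s e = trans (cong isMatchingᵇ (selected-snoc Es c (true ∷ s) true
                                              (cong suc (trans e (sym (LP.length-map shiftE (pathEdges (suc (suc k)))))))))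
                         (isMatching-snoc (selected Es (true ∷ s)) c)

    with-closing : ∀ s → length s ≡ length (pathEdges (suc (suc k))) →
      isCycleMatching ((false ∷ s) ∷ʳ true) ≡ AvoidingLast.admissible (suc (suc k)) (selected (pathEdges (suc (suc k))) s)
    with-closing s e = begin
      isMatchingᵇ (selected (E' ∷ʳ c) (s ∷ʳ true))
        ≡⟨ cong isMatchingᵇ (selected-snoc E' c s true (trans e (sym (LP.length-map shiftE (pathEdges (suc (suc k))))))) ⟩
      isMatchingᵇ (selected E' s ∷ʳ c)
        ≡⟨ isMatching-snoc (selected E' s) c ⟩
      all (λ e → disjointᵇ e c) (selected E' s) ∧ (isMatchingᵇ (selected E' s) ∧ true)
        ≡⟨ cong (λ z → all (λ e → disjointᵇ e c) z ∧ (isMatchingᵇ z ∧ true)) (selected-map shiftE (pathEdges (suc (suc k))) s) ⟩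
      all (λ e → disjointᵇ e c) (map shiftE X) ∧ (isMatchingᵇ (map shiftE X) ∧ true)
        ≡⟨ cong₂ (λ u v → u ∧ (v ∧ true)) (all-map (λ e → disjointᵇ e c) shiftE X) (isMatching-shift X) ⟩
      all (EdgeFilter.allowed avoidingLast (suc (suc k))) X ∧ (isMatchingᵇ X ∧ true)
        ≡⟨ swap (all (EdgeFilter.allowed avoidingLast (suc (suc k))) X) (isMatchingᵇ X) ⟩
      AvoidingLast.admissible (suc (suc k)) X ∎
      where
      open ≡-Reasoning
      X = selected (pathEdges (suc (suc k))) s
      swap : ∀ a b → a ∧ (b ∧ true) ≡ b ∧ a
      swap = solve 2 (λ a b → a :* (b :* con true) := b :* a) refl
        where open ∨-∧-Solver

    closing-used : filterᵇ (isCycleMatching ∘ (_∷ʳ true)) (allBools (length Es))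
                   ≡ map (false ∷_) (avoidingLastMatchings (suc (suc k)))
    closing-used = begin
      filterᵇ P (allBools (suc (length E')))
        ≡⟨ cong (λ L → filterᵇ P (allBools (suc L))) (LP.length-map shiftE (pathEdges (suc (suc k)))) ⟩
      filterᵇ P (allBools (suc L'))
        ≡⟨ filterᵇ-allBools-suc P L' ⟩
      map (false ∷_) (filterᵇ (P ∘ (false ∷_)) (allBools L')) ++ map (true ∷_) (filterᵇ (P ∘ (true ∷_)) (allBools L'))
        ≡⟨ cong₂ (λ u v → map (false ∷_) u ++ map (true ∷_) v)
                 (filterᵇ-congAll (All.map (λ {s} e → with-closing s e) (allBools-length L')))
                 (filterᵇ-none (All.map (λ {s} e → excluded s e) (allBools-length L'))) ⟩
      map (false ∷_) (avoidingLastMatchings (suc (suc k))) ++ []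
        ≡⟨ LP.++-identityʳ _ ⟩
      map (false ∷_) (avoidingLastMatchings (suc (suc k))) ∎
      where
      open ≡-Reasoning
      P : List Bool → Bool
      P = isCycleMatching ∘ (_∷ʳ true)
      L' : ℕ
      L' = length (pathEdges (suc (suc k)))

  cycle-split : ∀ k → cycleMatchings (suc (suc (suc k)))
    ↭ map (_∷ʳ false) (pathMatchings (suc (suc (suc k))))
      ++ map (λ s → false ∷ (s ∷ʳ true)) (avoidingLastMatchings (suc (suc k)))
  cycle-split k = begin
    filterᵇ P (allBools (length (Es ∷ʳ c)))
      ≡⟨ cong (λ L → filterᵇ P (allBools L)) (trans (LP.length-++ Es) (ℕP.+-comm (length Es) 1)) ⟩
    filterᵇ P (allBools (suc (length Es)))
      ↭⟨ PermP.filter-↭ (T? ∘ P) (allBools-snoc (length Es)) ⟩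
    filterᵇ P (map (_∷ʳ false) AB ++ map (_∷ʳ true) AB)
      ≡⟨ LP.filter-++ (T? ∘ P) (map (_∷ʳ false) AB) _ ⟩
    filterᵇ P (map (_∷ʳ false) AB) ++ filterᵇ P (map (_∷ʳ true) AB)
      ≡⟨ cong₂ _++_ (filterᵇ-map P (_∷ʳ false) AB) (filterᵇ-map P (_∷ʳ true) AB) ⟩
    map (_∷ʳ false) (filterᵇ (P ∘ (_∷ʳ false)) AB) ++ map (_∷ʳ true) (filterᵇ (P ∘ (_∷ʳ true)) AB)
      ≡⟨ cong₂ (λ u v → map (_∷ʳ false) u ++ map (_∷ʳ true) v) closing-unused closing-used ⟩
    map (_∷ʳ false) (pathMatchings (suc (suc (suc k)))) ++ map (_∷ʳ true) (map (false ∷_) (avoidingLastMatchings (suc (suc k))))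
      ≡⟨ cong (map (_∷ʳ false) (pathMatchings (suc (suc (suc k)))) ++_) (LP.map-∘ (avoidingLastMatchings (suc (suc k)))) ⟨
    map (_∷ʳ false) (pathMatchings (suc (suc (suc k)))) ++ map (λ s → false ∷ (s ∷ʳ true)) (avoidingLastMatchings (suc (suc k))) ∎
    where
    open Perm.PermutationReasoning
    open Cycle k
    P : List Bool → Bool
    P = isCycleMatching
    AB : List (List Bool)
    AB = allBools (length Es)

  cycle-fits : ∀ m → All (Fits (suc m)) (cycleMatchings (suc m))
  cycle-fits zero = z≤n ∷ []
  cycle-fits (suc zero) = z≤n ∷ s≤s (s≤s z≤n) ∷ s≤s (s≤s z≤n) ∷ []
  cycle-fits (suc (suc k)) = PermP.All-resp-↭ (↭-sym (cycle-split k)) (AllP.++⁺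
    (AllP.map⁺ (All.map (λ {s} f → subst (λ z → 2 ℕ.* z ≤ suc (suc (suc k))) (sym (countTrue-snoc-false s)) f)
                        (path-fits (suc (suc (suc k))))))
    (AllP.map⁺ (All.map (λ {s} f → subst (λ z → 2 ℕ.* z ≤ suc (suc (suc k))) (sym (countTrue-snoc-true s))
                                         (ℕP.≤-trans (ℕP.≤-reflexive (2*suc (countTrue s))) (s≤s (s≤s f))))
                        (avoidingLast-fits (suc k)))))

  Γ-cycle : ∀ m → Γ (cycleMatchings (suc m)) (suc m) ≈ onePoly +ₚ qpow (suc m)
  Γ-cycle zero = coeffwise λ { zero → refl ; (suc zero) → refl ; (suc (suc t)) → refl }
  Γ-cycle (suc zero) = coeffwise λ { zero → refl ; (suc zero) → refl ; (suc (suc zero)) → refl ; (suc (suc (suc t))) → refl }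
  Γ-cycle (suc (suc k)) = begin
    Γ (cycleMatchings m) m                     ≈⟨ Σₚ-↭ (PermP.map⁺ (γOf m) (cycle-split k)) ⟩
    Γ (unused ++ used) m                       ≈⟨ Γ-++ unused used m ⟩
    Γ unused m +ₚ Γ used m                     ≈⟨ +-cong closing-unused closing-used ⟩
    qint (suc m) +ₚ -q *ₚ qint (suc (suc k))   ≈⟨ qint-cycle (suc (suc k)) ⟩
    onePoly +ₚ qpow m ∎
    where
    open ≈-Reasoning
    m = suc (suc (suc k))
    unused used : List (List Bool)
    unused = map (_∷ʳ false) (pathMatchings m)
    used = map (λ s → false ∷ (s ∷ʳ true)) (avoidingLastMatchings (suc (suc k)))
    closing-unused : Γ unused m ≈ qint (suc m)
    closing-unused = ≈-trans (≈-reflexive (trans (Σₚ-map (γOf m) (_∷ʳ false) (pathMatchings m))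
        (cong Σₚ (LP.map-cong (λ s → cong (λ z → γ z (m ∸ 2 ℕ.* z)) (countTrue-snoc-false s)) (pathMatchings m)))))
      (Γ-path m)
    closing-used : Γ used m ≈ -q *ₚ qint (suc (suc k))
    closing-used = ≈-trans (≈-reflexive (Σₚ-map (γOf m) (λ s → false ∷ (s ∷ʳ true)) (avoidingLastMatchings (suc (suc k)))))
      (≈-trans (Σₚ-cong (avoidingLastMatchings (suc (suc k))) (λ s →
         ≈-trans (≈-reflexive (trans (cong (λ z → γ z (m ∸ 2 ℕ.* z)) (countTrue-snoc-true s))
                                     (cong (λ z → γ (suc (countTrue s)) (m ∸ z)) (2*suc (countTrue s)))))
                 (γ-sucˡ (countTrue s) (suc k ∸ 2 ℕ.* countTrue s))))
      (≈-trans (≈-sym (Σₚ-*ˡ -q (γOf (suc k)) (avoidingLastMatchings (suc (suc k))))) (*-congʳ -q (Γ-avoidingLast (suc k)))))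

-- Parts (1) and (2): [n]! = ∏_{m=1}^{n-1} [m+1] and ∏_{m=1}^n (1+q^m) are
-- products of γ-generating functions of paths, resp. cycles, with total
-- size 1 + 2 + ... + (n-1) = C(n,2), resp. C(n+1,2).
module ProductFormulas where

  open PolynomialRing
  open PolySums
  open GammaExpansion
  open PathMatchings using (path-fits; Γ-path)
  open CycleMatchings using (cycle-fits; Γ-cycle)
  open import Data.Nat as ℕ using (ℕ; zero; suc; _≤_; _≡ᵇ_)
  import Data.Nat.Properties as ℕP
  open import Data.Nat.Combinatorics using (_C_; nCk+nC[k+1]≡[n+1]C[k+1]; nC1≡n)
  open import Data.Nat.ListAction using (sum)
  open import Data.Nat.ListAction.Properties using (sum-++)
  open import Data.List using (List; _∷_; [_]; _++_; map; length; filterᵇ; upTo; cartesianProduct)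
  import Data.List.Properties as LP
  open import Data.List.Relation.Unary.All as All using (All)
  import Data.List.Relation.Unary.All.Properties as AllP
  open import Data.Bool using (Bool)
  open import Data.Product using (_,_; proj₁)
  open import Function using (_∘_)
  open import Relation.Binary.PropositionalEquality hiding ([_])

  oneTo-suc : ∀ n → oneTo (suc n) ≡ oneTo n ++ [ suc n ]
  oneTo-suc n = trans (cong (map suc) (sym (LP.upTo-∷ʳ n))) (LP.map-++ suc (upTo n) [ n ])

  sum-oneTo : ∀ n → sum (oneTo n) ≡ suc n C 2
  sum-oneTo zero = refl
  sum-oneTo (suc n) = begin
    sum (oneTo (suc n))                 ≡⟨ cong sum (oneTo-suc n) ⟩
    sum (oneTo n ++ [ suc n ])          ≡⟨ sum-++ (oneTo n) [ suc n ] ⟩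
    sum (oneTo n) ℕ.+ (suc n ℕ.+ 0)     ≡⟨ cong₂ ℕ._+_ (sum-oneTo n) (ℕP.+-identityʳ (suc n)) ⟩
    suc n C 2 ℕ.+ suc n                 ≡⟨ ℕP.+-comm (suc n C 2) (suc n) ⟩
    suc n ℕ.+ suc n C 2                 ≡⟨ cong (ℕ._+ suc n C 2) (nC1≡n (suc n)) ⟨
    suc n C 1 ℕ.+ suc n C 2             ≡⟨ nCk+nC[k+1]≡[n+1]C[k+1] (suc n) 1 ⟩
    suc (suc n) C 2 ∎
    where open ≡-Reasoning

  qfact-suc : ∀ n → qfact (suc n) ≈ prodP (map (qint ∘ suc) (oneTo n))
  qfact-suc n = ≈-trans (*-identityˡ _) (≈-reflexive (cong prodP (trans
    (cong (map qint ∘ map suc) (sym (LP.map-upTo suc n))) (sym (LP.map-∘ (oneTo n))))))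

  components : (ℕ → List (List Bool)) → List ℕ → List Component
  components F ms = map (λ m → (F m , m)) ms

  gvec-of-product : (ms : List ℕ) (F : ℕ → List (List Bool)) (Q : ℕ → Poly) (h : Poly) (d i : ℕ) →
    All (λ m → All (Fits m) (F m)) ms → All (λ m → Γ (F m) m ≈ Q m) ms →
    h ≈ prodP (map Q ms) → sum ms ≡ d → i ℕ.+ i ≤ d →
    gvec h i ≡ altSum i (λ j → length (cartesianProduct (filterᵇ (λ t → totalEdges t ≡ᵇ j) (seqs (map F ms))) (ℬ d i j)))
  gvec-of-product ms F Q h d i fits ΓF h≈ total le =
    subst₂ (λ D S → gvec h i ≡ altSum i (λ j → length (cartesianProduct
                       (filterᵇ (λ t → totalEdges t ≡ᵇ j) (seqs S)) (ℬ D i j))))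
           size families
           (gvec-of-Γ-product cs h (totalSize cs) i (AllP.map⁺ fits)
             (≈-trans h≈ (≈-trans (≈-sym (Πₚ-congAll ΓF)) (≈-reflexive (cong prodP (LP.map-∘ ms)))))
             refl (subst (i ℕ.+ i ≤_) (sym size) le))
    where
    cs : List Component
    cs = components F ms
    size : totalSize cs ≡ d
    size = trans (cong sum (sym (LP.map-∘ ms))) (trans (cong sum (LP.map-id ms)) total)
    families : map proj₁ cs ≡ map F ms
    families = sym (LP.map-∘ ms)

  2*≤⇒+≤ : ∀ i d → 2 ℕ.* i ≤ d → i ℕ.+ i ≤ d
  2*≤⇒+≤ i d = ℕP.≤-trans (ℕP.≤-reflexive (cong (i ℕ.+_) (sym (ℕP.+-identityʳ i))))

  forOneTo : {P : ℕ → Set} → (∀ m → P (suc m)) → ∀ n → All P (oneTo n)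
  forOneTo f n = AllP.map⁺ (All.universal f (upTo n))

  qfact-gvec : (n i : ℕ) → 1 ≤ n → 2 ℕ.* i ≤ n C 2 →
    gvec (qfact n) i ≡ altSum i (λ j → length (cartesianProduct (𝒯 n j) (ℬ (n C 2) i j)))
  qfact-gvec (suc n) i _ le = gvec-of-product (oneTo n) pathMatchings (qint ∘ suc) (qfact (suc n)) (suc n C 2) i
    (All.universal path-fits _) (All.universal Γ-path _) (qfact-suc n) (sum-oneTo n) (2*≤⇒+≤ i _ le)

  prodOnePlusQ-gvec : (n i : ℕ) → 1 ≤ n → 2 ℕ.* i ≤ suc n C 2 →
    gvec (prodOnePlusQ n) i ≡ altSum i (λ j → length (cartesianProduct (𝒯′ n j) (ℬ (suc n C 2) i j)))
  prodOnePlusQ-gvec n i _ le = gvec-of-product (oneTo n) cycleMatchings (λ m → onePoly +ₚ qpow m) (prodOnePlusQ n) (suc n C 2) i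
    (forOneTo cycle-fits n) (forOneTo Γ-cycle n) ≈-refl (sum-oneTo n) (2*≤⇒+≤ i _ le)

-- A polynomial with constant term 1 is not a zero divisor; used to divide
-- the identity p·[k]![n-k]! = [n]! by [k]![n-k]!.
module Cancellation where

  open PolynomialRing
  open import Data.Integer as ℤ using (ℤ; 0ℤ; 1ℤ)
  import Data.Integer.Properties as ℤP
  open import Data.Nat using (zero; suc)
  open import Data.List using ([]; _∷_)
  open import Relation.Binary.PropositionalEquality

  coeff-*-zero : ∀ a b → coeff (a *ₚ b) 0 ≡ coeff a 0 ℤ.* coeff b 0
  coeff-*-zero [] b = sym (ℤP.*-zeroˡ (coeff b 0))
  coeff-*-zero (x ∷ a) b = trans (coeff-+ (scale x b) (shift (a *ₚ b)) 0) (trans (ℤP.+-identityʳ _) (coeff-scale x b 0))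

  -- If r·D = 0 and D has constant term 1 then r = 0 (compare lowest coefficients).
  cancel-zero : ∀ r D → coeff D 0 ≡ 1ℤ → r *ₚ D ≈ [] → r ≈ []
  cancel-zero [] D c₀ rD≈0 = ≈-refl
  cancel-zero (a ∷ r) D c₀ rD≈0 = coeffwise λ { zero → a≡0 ; (suc t) → at (cancel-zero r D c₀ tail) t }
    where
    -- the constant term of (a ∷ r)·D is a·1
    a≡0 : a ≡ 0ℤ
    a≡0 = begin
      a                                ≡⟨ ℤP.*-identityʳ a ⟨
      a ℤ.* 1ℤ                         ≡⟨ cong (a ℤ.*_) c₀ ⟨
      a ℤ.* coeff D 0                  ≡⟨ coeff-*-zero (a ∷ r) D ⟨
      coeff ((a ∷ r) *ₚ D) 0           ≡⟨ at rD≈0 0 ⟩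
      0ℤ ∎
      where open ≡-Reasoning
    scaled-away : ∀ t → coeff (scale a D) (suc t) ≡ 0ℤ
    scaled-away t = trans (coeff-scale a D (suc t)) (trans (cong (ℤ._* coeff D (suc t)) a≡0) (ℤP.*-zeroˡ (coeff D (suc t))))
    -- hence (a ∷ r)·D = q·(r·D)
    tail : r *ₚ D ≈ []
    tail = coeffwise λ t → begin
      coeff (r *ₚ D) t                                    ≡⟨ ℤP.+-identityˡ _ ⟨
      0ℤ ℤ.+ coeff (r *ₚ D) t                             ≡⟨ cong (ℤ._+ coeff (r *ₚ D) t) (sym (scaled-away t)) ⟩
      coeff (scale a D) (suc t) ℤ.+ coeff (r *ₚ D) t      ≡⟨ coeff-+ (scale a D) (shift (r *ₚ D)) (suc t) ⟨
      coeff ((a ∷ r) *ₚ D) (suc t)                        ≡⟨ at rD≈0 (suc t) ⟩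
      0ℤ ∎
      where open ≡-Reasoning

  cancel : ∀ p r D → coeff D 0 ≡ 1ℤ → p *ₚ D ≈ r *ₚ D → p ≈ r
  cancel p r D c₀ pD≈rD = coeffwise λ t → difference-zero t (at (cancel-zero (p +ₚ negₚ r) D c₀ difference) t)
    where
    difference : (p +ₚ negₚ r) *ₚ D ≈ []
    difference = ≈-trans (*-distribʳ p (negₚ r) D)
      (≈-trans (+-cong pD≈rD (*-scaleˡ (ℤ.- 1ℤ) r D)) (+-inverseʳ (r *ₚ D)))
    difference-zero : ∀ t → coeff (p +ₚ negₚ r) t ≡ 0ℤ → coeff p t ≡ coeff r t
    difference-zero t z = ℤP.i-j≡0⇒i≡j (coeff p t) (coeff r t)
      (trans (sym (trans (coeff-+ p (negₚ r) t) (cong (λ z → coeff p t ℤ.+ z) (coeff-neg r t)))) z)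

-- Strict matchings of a path (first vertex covered) use the first edge, so
-- their γ-generating function is -q[c-1] (and 1 for the empty path).
module StrictMatchings where

  open PolynomialRing
  open GammaBasis
  open ListTools
  open GammaExpansion using (Γ; Fits)
  open PathMatchings
  open import Data.Nat using (ℕ; zero; suc; z≤n)
  open import Data.List using (List; []; _∷_; _++_; map; filterᵇ)
  open import Data.List.Relation.Unary.All as All using (All; []; _∷_)
  import Data.List.Relation.Unary.All.Properties as AllP
  open import Data.Bool using (Bool; true; false; _∨_; T?)
  open import Data.Bool.ListAction using (any)
  open import Data.Fin using (zero)
  open import Data.Product using (proj₁; proj₂)
  open import Function using (_∘_)
  open import Relation.Binary.PropositionalEquality
  import Data.List.Properties as LP

  strict-fits : ∀ c → All (Fits c) (strictMatchings c)
  strict-fits zero = z≤n ∷ []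
  strict-fits (suc c) = AllP.filter⁺ _ (path-fits (suc c))

  -- Only the matchings using the first edge {0,1} cover vertex 0.
  strict-rec : ∀ k → strictMatchings (suc (suc (suc k))) ≡ map (λ s → true ∷ false ∷ s) (pathMatchings (suc k))
  strict-rec k = begin
    filterᵇ covers0 (pathMatchings (suc (suc (suc k))))
      ≡⟨ cong (filterᵇ covers0) (pathMatchings-rec k) ⟩
    filterᵇ covers0 (map (false ∷_) X ++ map (λ s → true ∷ false ∷ s) Y)
      ≡⟨ LP.filter-++ (T? ∘ covers0) (map (false ∷_) X) _ ⟩
    filterᵇ covers0 (map (false ∷_) X) ++ filterᵇ covers0 (map (λ s → true ∷ false ∷ s) Y)
      ≡⟨ cong₂ _++_ (trans (filterᵇ-map covers0 (false ∷_) X)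
                           (cong (map (false ∷_)) (filterᵇ-none (All.universal first-unused X))))
                    (trans (filterᵇ-map covers0 (λ s → true ∷ false ∷ s) Y)
                           (cong (map (λ s → true ∷ false ∷ s)) (filterᵇ-all (All.universal (λ _ → refl) Y)))) ⟩
    map (λ s → true ∷ false ∷ s) Y ∎
    where
    open ≡-Reasoning
    X = pathMatchings (suc (suc k))
    Y = pathMatchings (suc k)
    touches0 : Edge (suc (suc (suc k))) → Bool
    touches0 e = (proj₁ e == zero) ∨ (proj₂ e == zero)
    covers0 : List Bool → Bool
    covers0 s = any touches0 (selected (pathEdges (suc (suc (suc k)))) s)
    shifted-miss0 : (xs : List (Edge (suc (suc k)))) → any touches0 (map shiftE xs) ≡ false
    shifted-miss0 [] = refl
    shifted-miss0 (x ∷ xs) = shifted-miss0 xs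
    first-unused : ∀ s → covers0 (false ∷ s) ≡ false
    first-unused s = trans (cong (any touches0) (selected-map shiftE (pathEdges (suc (suc k))) s))
                           (shifted-miss0 (selected (pathEdges (suc (suc k))) s))

  strictΓ : ℕ → Poly
  strictΓ zero = onePoly
  strictΓ (suc c) = -q *ₚ qint c

  Γ-strict : ∀ c → Γ (strictMatchings c) c ≈ strictΓ c
  Γ-strict zero = coeffwise λ { zero → refl ; (suc t) → refl }
  Γ-strict (suc zero) = ≈-sym (*-zeroʳ -q)
  Γ-strict (suc (suc zero)) = coeffwise λ { zero → refl ; (suc zero) → refl ; (suc (suc t)) → refl }
  Γ-strict (suc (suc (suc k))) =
    ≈-trans (≈-reflexive (cong (λ X → Γ X (suc (suc (suc k)))) (strict-rec k)))
    (≈-trans (Γ-extend [] (pathMatchings (suc k)) (suc k) [])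
    (≈-trans (+-cong (*-zeroʳ 1+q) (≈-refl { -q *ₚ Γ (pathMatchings (suc k)) (suc k)})) (*-congʳ -q (Γ-path (suc k)))))

module Partitions where

  open ListTools
  open import Data.Nat as ℕ using (ℕ; zero; suc; _∸_; _≤_; _<_; z≤n; s≤s; _≤ᵇ_)
  import Data.Nat.Properties as ℕP
  open import Data.Nat.ListAction using (sum)
  open import Data.Nat.ListAction.Properties using (sum-++)
  open import Data.List using (List; []; _∷_; _++_; [_]; map; length; filterᵇ; replicate; upTo; applyUpTo; concatMap)
  import Data.List.Properties as LP
  open import Data.List.Relation.Unary.All as All using (All; []; _∷_)
  import Data.List.Relation.Unary.All.Properties as AllP
  open import Data.Bool using (Bool; true; false; _∧_; T?)
  open import Data.Bool.ListAction using (all)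
  open import Data.Bool.Properties using (T-≡)
  open import Data.Product using (_×_; _,_)
  open import Function using (_∘_)
  open import Function.Bundles using (Equivalence)
  open import Relation.Binary.PropositionalEquality hiding ([_])
  open import Relation.Nullary using (yes; no)
  open import Data.Empty using (⊥-elim)

  boxPartitions : ℕ → ℕ → List (List ℕ)
  boxPartitions zero m = [ [] ]
  boxPartitions (suc k) m = concatMap (λ a → map (a ∷_) (boxPartitions k a)) (upTo (suc m))

  ≤⇒≤ᵇ : ∀ {x a} → x ≤ a → (x ≤ᵇ a) ≡ true
  ≤⇒≤ᵇ le = Equivalence.to T-≡ (ℕP.≤⇒≤ᵇ le)

  ≤ᵇ⇒≤ : ∀ x a → (x ≤ᵇ a) ≡ true → x ≤ a
  ≤ᵇ⇒≤ x a e = ℕP.≤ᵇ⇒≤ x a (Equivalence.from T-≡ e)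

  allAtMost : ℕ → List ℕ → Bool
  allAtMost a l = all (λ x → x ≤ᵇ a) l

  allAtMost-mono : ∀ {y a} → y ≤ a → ∀ l → allAtMost y l ≡ true → allAtMost a l ≡ true
  allAtMost-mono le [] e = refl
  allAtMost-mono {y} {a} le (x ∷ l) e with x ≤ᵇ y in x≤y
  -- (when x ≤ᵇ y is false, e : false ≡ true is absurd)
  ... | true = trans (cong (_∧ allAtMost a l) (≤⇒≤ᵇ (ℕP.≤-trans (≤ᵇ⇒≤ x y x≤y) le))) (allAtMost-mono le l e)

  weaklyDecreasing-∷ : ∀ a l → weaklyDecreasingᵇ (a ∷ l) ≡ allAtMost a l ∧ weaklyDecreasingᵇ l
  weaklyDecreasing-∷ a [] = refl
  weaklyDecreasing-∷ a (y ∷ l) rewrite weaklyDecreasing-∷ y l with y ≤ᵇ a in y≤a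
  ... | false = refl
  ... | true with allAtMost y l in l≤y
  ...   | false = sym (∧-zeroʳ _)
    where open import Data.Bool.Properties using (∧-zeroʳ)
  ...   | true rewrite allAtMost-mono (≤ᵇ⇒≤ y a y≤a) l l≤y = refl

  filter-upTo : ∀ a m → a ≤ m → filterᵇ (λ x → x ≤ᵇ a) (upTo (suc m)) ≡ upTo (suc a)
  filter-upTo a zero z≤n = refl
  filter-upTo a (suc m) le with a ℕP.≤? m
  ... | yes a≤m = begin
    filterᵇ P (upTo (suc (suc m)))                        ≡⟨ cong (filterᵇ P) (LP.upTo-∷ʳ (suc m)) ⟨
    filterᵇ P (upTo (suc m) ++ [ suc m ])                 ≡⟨ LP.filter-++ (T? ∘ P) (upTo (suc m)) [ suc m ] ⟩
    filterᵇ P (upTo (suc m)) ++ filterᵇ P [ suc m ]       ≡⟨ cong₂ _++_ (filter-upTo a m a≤m) last-rejected ⟩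
    upTo (suc a) ++ []                                    ≡⟨ LP.++-identityʳ _ ⟩
    upTo (suc a) ∎
    where
    open ≡-Reasoning
    P : ℕ → Bool
    P x = x ≤ᵇ a
    last-rejected : filterᵇ P [ suc m ] ≡ []
    last-rejected with suc m ≤ᵇ a in m<a
    ... | true = ⊥-elim (ℕP.<⇒≱ (s≤s a≤m) (≤ᵇ⇒≤ (suc m) a m<a))
    ... | false = refl
  ... | no a≰m rewrite ℕP.≤-antisym le (ℕP.≰⇒> a≰m) =
    filterᵇ-all (All.map (λ lt → ≤⇒≤ᵇ (ℕP.≤-pred lt)) (AllP.all-upTo (suc (suc m))))

  boxPartitions-spec : ∀ k m → filterᵇ weaklyDecreasingᵇ (seqs (replicate k (upTo (suc m)))) ≡ boxPartitions k m
  boxPartitions-spec zero m = refl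
  boxPartitions-spec (suc k) m =
    trans (filterᵇ-concatMap weaklyDecreasingᵇ (λ a → map (a ∷_) S) U)
          (concatMap-congAll (All.map (λ {a} lt → with-first a (ℕP.≤-pred lt)) (AllP.all-upTo (suc m))))
    where
    U = upTo (suc m)
    S = seqs (replicate k U)
    concatMap-congAll : {f g : ℕ → List (List ℕ)} {xs : List ℕ} →
      All (λ x → f x ≡ g x) xs → concatMap f xs ≡ concatMap g xs
    concatMap-congAll [] = refl
    concatMap-congAll (e ∷ es) = cong₂ _++_ e (concatMap-congAll es)
    with-first : ∀ a → a ≤ m → filterᵇ weaklyDecreasingᵇ (map (a ∷_) S) ≡ map (a ∷_) (boxPartitions k a)
    with-first a le = begin
      filterᵇ weaklyDecreasingᵇ (map (a ∷_) S)
        ≡⟨ filterᵇ-map weaklyDecreasingᵇ (a ∷_) S ⟩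
      map (a ∷_) (filterᵇ (weaklyDecreasingᵇ ∘ (a ∷_)) S)
        ≡⟨ cong (map (a ∷_)) (filterᵇ-congAll (All.universal (weaklyDecreasing-∷ a) S)) ⟩
      map (a ∷_) (filterᵇ (λ l → allAtMost a l ∧ weaklyDecreasingᵇ l) S)
        ≡⟨ cong (map (a ∷_)) (filterᵇ-filterᵇ weaklyDecreasingᵇ (allAtMost a) S) ⟨
      map (a ∷_) (filterᵇ weaklyDecreasingᵇ (filterᵇ (allAtMost a) S))
        ≡⟨ cong (λ z → map (a ∷_) (filterᵇ weaklyDecreasingᵇ z)) (filterᵇ-all-seqs (λ x → x ≤ᵇ a) (replicate k U)) ⟩
      map (a ∷_) (filterᵇ weaklyDecreasingᵇ (seqs (map (filterᵇ (λ x → x ≤ᵇ a)) (replicate k U))))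
        ≡⟨ cong (λ z → map (a ∷_) (filterᵇ weaklyDecreasingᵇ (seqs z)))
                (trans (LP.map-replicate _ k U) (cong (replicate k) (filter-upTo a m le))) ⟩
      map (a ∷_) (filterᵇ weaklyDecreasingᵇ (seqs (replicate k (upTo (suc a)))))
        ≡⟨ cong (map (a ∷_)) (boxPartitions-spec k a) ⟩
      map (a ∷_) (boxPartitions k a) ∎
      where open ≡-Reasoning

  -- The thresholds m, m-1, ..., 1 = n-k+1-r for r = 1..m, m = n-k.
  thresholds : ℕ → List ℕ
  thresholds zero = []
  thresholds (suc m) = suc m ∷ thresholds m

  thresholds-≤ : ∀ a → All (λ τ → τ ≤ a) (thresholds a)
  thresholds-≤ zero = []
  thresholds-≤ (suc a) = ℕP.≤-refl ∷ All.map ℕP.m≤n⇒m≤1+n (thresholds-≤ a)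

  complementOf : ℕ → List ℕ → List ℕ → List ℕ
  complementOf k lam τs = map (λ τ → k ∸ countᵇ (τ ≤ᵇ_) lam) τs

  complementP≡ : ∀ n k lam → complementP n k lam ≡ complementOf k lam (thresholds (n ∸ k))
  complementP≡ n k lam =
    trans (LP.map-∘ (oneTo (n ∸ k))) (cong (complementOf k lam) (thresholds-spec (n ∸ k)))
    where
    thresholds-applyUpTo : ∀ M → applyUpTo (M ∸_) M ≡ thresholds M
    thresholds-applyUpTo zero = refl
    thresholds-applyUpTo (suc M) = cong (suc M ∷_) (thresholds-applyUpTo M)
    thresholds-spec : ∀ M → map (λ r → suc M ∸ r) (oneTo M) ≡ thresholds M
    thresholds-spec M = trans (sym (LP.map-∘ (upTo M))) (trans (LP.map-applyUpTo (λ x → x) (M ∸_) M) (thresholds-applyUpTo M))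

  map-congAll : {A B : Set} {f g : A → B} {xs : List A} → All (λ x → f x ≡ g x) xs → map f xs ≡ map g xs
  map-congAll [] = refl
  map-congAll (e ∷ es) = cong₂ _∷_ e (map-congAll es)

  countᵇ-none : {A : Set} (p : A → Bool) {xs : List A} → All (λ x → p x ≡ false) xs → countᵇ p xs ≡ 0
  countᵇ-none p ps = cong length (filterᵇ-none ps)

  countᵇ-∷-true : {A : Set} (p : A → Bool) (x : A) (xs : List A) → p x ≡ true → countᵇ p (x ∷ xs) ≡ suc (countᵇ p xs)
  countᵇ-∷-true p x xs px rewrite px = refl

  <⇒≤ᵇ-false : ∀ {τ x} → x < τ → (τ ≤ᵇ x) ≡ false
  <⇒≤ᵇ-false {τ} {x} lt with τ ≤ᵇ x in τ≤x
  ... | false = refl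
  ... | true = ⊥-elim (ℕP.<⇒≱ lt (≤ᵇ⇒≤ τ x τ≤x))

  complement-∷ : ∀ k a lam' d → All (λ x → x ≤ a) lam' →
    complementOf (suc k) (a ∷ lam') (thresholds (d ℕ.+ a)) ≡ replicate d (suc k) ++ complementOf k lam' (thresholds a)
  complement-∷ k a lam' zero lam'≤a = map-congAll (All.map (λ {τ} τ≤a →
    cong (suc k ∸_) (countᵇ-∷-true (τ ≤ᵇ_) a lam' (≤⇒≤ᵇ τ≤a))) (thresholds-≤ a))
  complement-∷ k a lam' (suc d) lam'≤a = cong₂ _∷_
    (cong (suc k ∸_) (countᵇ-none (suc d ℕ.+ a ≤ᵇ_) {a ∷ lam'}
      (<⇒≤ᵇ-false a<τ ∷ All.map (λ {x} x≤a → <⇒≤ᵇ-false {x = x} (ℕP.≤-trans (s≤s x≤a) a<τ)) lam'≤a)))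
    (complement-∷ k a lam' d lam'≤a)
    where
    a<τ : a < suc (d ℕ.+ a)
    a<τ = s≤s (ℕP.m≤n+m a d)

  sum-replicate : ∀ d x → sum (replicate d x) ≡ d ℕ.* x
  sum-replicate zero x = refl
  sum-replicate (suc d) x = cong (x ℕ.+_) (sum-replicate d x)

  InBox : ℕ → ℕ → List ℕ → Set
  InBox k m lam = All (λ x → x ≤ m) lam × (sum lam ℕ.+ sum (complementOf k lam (thresholds m)) ≡ k ℕ.* m)

  boxPartitions-inBox : ∀ k m → All (InBox k m) (boxPartitions k m)
  boxPartitions-inBox zero m = ([] , trans (sum-zeros (thresholds m)) (sym (ℕP.*-zeroˡ m))) ∷ []
    where
    sum-zeros : ∀ (τs : List ℕ) → sum (map (λ _ → 0) τs) ≡ 0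
    sum-zeros [] = refl
    sum-zeros (x ∷ τs) = sum-zeros τs
  boxPartitions-inBox (suc k) m = AllP.concat⁺ (AllP.map⁺
    (All.map (λ {a} lt → AllP.map⁺ (All.map (λ {lam'} → with-first a (ℕP.≤-pred lt) lam') (boxPartitions-inBox k a)))
             (AllP.all-upTo (suc m))))
    where
    with-first : ∀ a → a ≤ m → ∀ lam' → InBox k a lam' → InBox (suc k) m (a ∷ lam')
    with-first a a≤m lam' (lam'≤a , size) = (a≤m ∷ All.map (λ l → ℕP.≤-trans l a≤m) lam'≤a) , (begin
      (a ℕ.+ L) ℕ.+ sum (complementOf (suc k) (a ∷ lam') (thresholds m))
        ≡⟨ cong (λ z → (a ℕ.+ L) ℕ.+ sum (complementOf (suc k) (a ∷ lam') (thresholds z))) (sym (ℕP.m∸n+n≡m a≤m)) ⟩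
      (a ℕ.+ L) ℕ.+ sum (complementOf (suc k) (a ∷ lam') (thresholds (d ℕ.+ a)))
        ≡⟨ cong (λ z → (a ℕ.+ L) ℕ.+ sum z) (complement-∷ k a lam' d lam'≤a) ⟩
      (a ℕ.+ L) ℕ.+ sum (replicate d (suc k) ++ complementOf k lam' (thresholds a))
        ≡⟨ cong ((a ℕ.+ L) ℕ.+_) (trans (sum-++ (replicate d (suc k)) _) (cong (ℕ._+ L*) (sum-replicate d (suc k)))) ⟩
      (a ℕ.+ L) ℕ.+ (d ℕ.* suc k ℕ.+ L*)   ≡⟨ regroup a L d k L* ⟩
      (a ℕ.+ d ℕ.* suc k) ℕ.+ (L ℕ.+ L*)   ≡⟨ cong ((a ℕ.+ d ℕ.* suc k) ℕ.+_) size ⟩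
      (a ℕ.+ d ℕ.* suc k) ℕ.+ k ℕ.* a     ≡⟨ collect a d k ⟩
      suc k ℕ.* (d ℕ.+ a)                 ≡⟨ cong (suc k ℕ.*_) (ℕP.m∸n+n≡m a≤m) ⟩
      suc k ℕ.* m ∎)
      where
      open ≡-Reasoning
      d L L* : ℕ
      d = m ∸ a
      L = sum lam'
      L* = sum (complementOf k lam' (thresholds a))
      open import Data.Nat.Tactic.RingSolver
      regroup : ∀ a L d k M → (a ℕ.+ L) ℕ.+ (d ℕ.* suc k ℕ.+ M) ≡ (a ℕ.+ d ℕ.* suc k) ℕ.+ (L ℕ.+ M)
      regroup = solve-∀
      collect : ∀ a d k → (a ℕ.+ d ℕ.* suc k) ℕ.+ k ℕ.* a ≡ suc k ℕ.* (d ℕ.+ a)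
      collect = solve-∀

-- The lucanomial identity: Σ_λ w(λ) · [k]![m]! = [k+m]!, where λ runs over
-- the partitions in the k × m box and w(λ) = ∏_r [λ_r+1] · ∏_τ strictΓ(λ*_τ).
-- Splitting off the largest part a of λ gives the recursion
--   S(k+1,m) = Σ_{a ≤ m} [a+1] (-q[k])^{m-a} S(k,a),
-- and the identity follows by induction from [a+1][k+1] - q[a][k] = [a+k+1].
module LucanomialIdentity where

  open PolynomialRing
  open PolySums
  open GammaBasis
  open QIntegers
  open StrictMatchings using (strictΓ)
  open Partitions
  open ProductFormulas using (oneTo-suc)
  open import Data.Nat as ℕ using (ℕ; zero; suc; _∸_; _≤_)
  import Data.Nat.Properties as ℕP
  open import Data.List using (List; []; _∷_; [_]; _++_; map; replicate; upTo)
  import Data.List.Properties as LP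
  open import Data.List.Relation.Unary.All as All using (All)
  import Data.List.Relation.Unary.All.Properties as AllP
  open import Data.Product using (proj₁)
  open import Function using (_∘_)
  open import Relation.Binary.PropositionalEquality hiding ([_])
  open import Tactic.RingSolver.NonReflective polyAlmostRing
  open ≈-Reasoning

  qfact-suc : ∀ n → qfact (suc n) ≈ qfact n *ₚ qint (suc n)
  qfact-suc n = ≈-trans (≈-reflexive (cong prodP (trans (cong (map qint) (oneTo-suc n)) (LP.map-++ qint (oneTo n) [ suc n ]))))
    (≈-trans (Πₚ-++ (map qint (oneTo n)) [ qint (suc n) ]) (*-congʳ (qfact n) (*-identityʳ (qint (suc n)))))

  -- w(λ) = ∏_r [λ_r+1] · ∏_τ strictΓ(λ*_τ): the product of the Γ's of the components of λ.
  weight : ℕ → ℕ → List ℕ → Poly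
  weight k m lam = prodP (map (qint ∘ suc) lam) *ₚ prodP (map strictΓ (complementOf k lam (thresholds m)))

  lucanomialSum : ℕ → ℕ → Poly
  lucanomialSum k m = Σₚ (map (weight k m) (boxPartitions k m))

  -- The factor contributed by a full column of height k+1 in the complement.
  column : ℕ → Poly
  column k = strictΓ (suc k)

  weight-∷ : ∀ k m a lam' → a ≤ m → All (λ x → x ≤ a) lam' →
    weight (suc k) m (a ∷ lam') ≈ qint (suc a) *ₚ (column k ^ₚ (m ∸ a) *ₚ weight k a lam')
  weight-∷ k m a lam' a≤m lam'≤a = begin
    (qint (suc a) *ₚ Parts) *ₚ prodP (map strictΓ (complementOf (suc k) (a ∷ lam') (thresholds m)))
      ≈⟨ *-congʳ (qint (suc a) *ₚ Parts) (≈-reflexive (cong (prodP ∘ map strictΓ) complement)) ⟩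
    (qint (suc a) *ₚ Parts) *ₚ prodP (map strictΓ (replicate (m ∸ a) (suc k) ++ complementOf k lam' (thresholds a)))
      ≈⟨ *-congʳ (qint (suc a) *ₚ Parts) (≈-trans (≈-reflexive (cong prodP (LP.map-++ strictΓ (replicate (m ∸ a) (suc k)) _)))
           (≈-trans (Πₚ-++ (map strictΓ (replicate (m ∸ a) (suc k))) _)
                    (*-congˡ Rest (≈-trans (≈-reflexive (cong prodP (LP.map-replicate strictΓ (m ∸ a) (suc k))))
                                         (Πₚ-replicate (column k) (m ∸ a)))))) ⟩
    (qint (suc a) *ₚ Parts) *ₚ (column k ^ₚ (m ∸ a) *ₚ Rest)
      ≈⟨ solve 4 (λ A P G R → ((A ⊗ P) ⊗ (G ⊗ R)) ⊜ (A ⊗ (G ⊗ (P ⊗ R)))) ≈-refl (qint (suc a)) Parts (column k ^ₚ (m ∸ a)) Rest ⟩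
    qint (suc a) *ₚ (column k ^ₚ (m ∸ a) *ₚ weight k a lam') ∎
    where
    Parts Rest : Poly
    Parts = prodP (map (qint ∘ suc) lam')
    Rest = prodP (map strictΓ (complementOf k lam' (thresholds a)))
    complement : complementOf (suc k) (a ∷ lam') (thresholds m) ≡ replicate (m ∸ a) (suc k) ++ complementOf k lam' (thresholds a)
    complement = trans (cong (λ z → complementOf (suc k) (a ∷ lam') (thresholds z)) (sym (ℕP.m∸n+n≡m a≤m)))
                       (complement-∷ k a lam' (m ∸ a) lam'≤a)

  firstPartSum : ℕ → ℕ → Poly
  firstPartSum k m = Σₚ (map (λ a → qint (suc a) *ₚ (column k ^ₚ (m ∸ a) *ₚ lucanomialSum k a)) (upTo (suc m)))

  lucanomialSum-suc : ∀ k m → lucanomialSum (suc k) m ≈ firstPartSum k m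
  lucanomialSum-suc k m = ≈-trans (Σₚ-concatMap (weight (suc k) m) (λ a → map (a ∷_) (boxPartitions k a)) (upTo (suc m)))
    (Σₚ-congAll (All.map (λ {a} lt → with-first a (ℕP.≤-pred lt)) (AllP.all-upTo (suc m))))
    where
    with-first : ∀ a → a ≤ m →
      Σₚ (map (weight (suc k) m) (map (a ∷_) (boxPartitions k a))) ≈ qint (suc a) *ₚ (column k ^ₚ (m ∸ a) *ₚ lucanomialSum k a)
    with-first a a≤m = begin
      Σₚ (map (weight (suc k) m) (map (a ∷_) (boxPartitions k a)))   ≡⟨ Σₚ-map (weight (suc k) m) (a ∷_) (boxPartitions k a) ⟩
      Σₚ (map (λ lam' → weight (suc k) m (a ∷ lam')) (boxPartitions k a))
        ≈⟨ Σₚ-congAll (All.map (λ {lam'} inBox → weight-∷ k m a lam' a≤m (proj₁ inBox)) (boxPartitions-inBox k a)) ⟩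
      Σₚ (map (λ lam' → qint (suc a) *ₚ (column k ^ₚ (m ∸ a) *ₚ weight k a lam')) (boxPartitions k a))
        ≈⟨ Σₚ-*ˡ (qint (suc a)) (λ lam' → column k ^ₚ (m ∸ a) *ₚ weight k a lam') (boxPartitions k a) ⟨
      qint (suc a) *ₚ Σₚ (map (λ lam' → column k ^ₚ (m ∸ a) *ₚ weight k a lam') (boxPartitions k a))
        ≈⟨ *-congʳ (qint (suc a)) (Σₚ-*ˡ (column k ^ₚ (m ∸ a)) (weight k a) (boxPartitions k a)) ⟨
      qint (suc a) *ₚ (column k ^ₚ (m ∸ a) *ₚ lucanomialSum k a) ∎

  firstPartSum-suc : ∀ k m → firstPartSum k (suc m) ≈ column k *ₚ firstPartSum k m +ₚ qint (suc (suc m)) *ₚ lucanomialSum k (suc m)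
  firstPartSum-suc k m = begin
    Σₚ (map (term (suc m)) (upTo (suc (suc m))))             ≡⟨ cong (Σₚ ∘ map (term (suc m))) (LP.upTo-∷ʳ (suc m)) ⟨
    Σₚ (map (term (suc m)) (upTo (suc m) ++ [ suc m ]))      ≈⟨ ≈-trans (≈-reflexive (cong Σₚ (LP.map-++ (term (suc m)) (upTo (suc m)) [ suc m ])))
                                                                       (Σₚ-++ (map (term (suc m)) (upTo (suc m))) [ term (suc m) (suc m) ]) ⟩
    Σₚ (map (term (suc m)) (upTo (suc m))) +ₚ (term (suc m) (suc m) +ₚ [])
      ≈⟨ +-cong earlier (≈-trans (+-identityʳ _) last) ⟩
    column k *ₚ firstPartSum k m +ₚ qint (suc (suc m)) *ₚ lucanomialSum k (suc m) ∎
    where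
    term : ℕ → ℕ → Poly
    term m a = qint (suc a) *ₚ (column k ^ₚ (m ∸ a) *ₚ lucanomialSum k a)
    earlier : Σₚ (map (term (suc m)) (upTo (suc m))) ≈ column k *ₚ firstPartSum k m
    earlier = ≈-trans (Σₚ-congAll (All.map (λ {a} lt → one-more a (ℕP.≤-pred lt)) (AllP.all-upTo (suc m))))
                      (≈-sym (Σₚ-*ˡ (column k) (term m) (upTo (suc m))))
      where
      one-more : ∀ a → a ≤ m → term (suc m) a ≈ column k *ₚ term m a
      one-more a a≤m = ≈-trans (≈-reflexive (cong (λ z → qint (suc a) *ₚ (column k ^ₚ z *ₚ lucanomialSum k a)) (ℕP.+-∸-assoc 1 a≤m)))
        (solve 4 (λ A G Pw F → (A ⊗ ((G ⊗ Pw) ⊗ F)) ⊜ (G ⊗ (A ⊗ (Pw ⊗ F)))) ≈-refl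
                 (qint (suc a)) (column k) (column k ^ₚ (m ∸ a)) (lucanomialSum k a))
    last : term (suc m) (suc m) ≈ qint (suc (suc m)) *ₚ lucanomialSum k (suc m)
    last = *-congʳ (qint (suc (suc m))) (≈-trans (≈-reflexive (cong (λ z → column k ^ₚ z *ₚ lucanomialSum k (suc m)) (ℕP.n∸n≡0 m)))
                                                 (*-identityˡ (lucanomialSum k (suc m))))

  lucanomial-zero : ∀ m → lucanomialSum 0 m ≈ onePoly
  lucanomial-zero m = ≈-trans (+-identityʳ _) (≈-trans (*-identityˡ _) (no-columns (thresholds m)))
    where
    no-columns : ∀ (τs : List ℕ) → prodP (map strictΓ (map (λ _ → 0) τs)) ≈ onePoly
    no-columns [] = ≈-refl
    no-columns (τ ∷ τs) = ≈-trans (*-identityˡ _) (no-columns τs)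

  firstPart-identity : ∀ k → (∀ m → lucanomialSum k m *ₚ (qfact k *ₚ qfact m) ≈ qfact (k ℕ.+ m)) →
    ∀ m → firstPartSum k m *ₚ (qfact (suc k) *ₚ qfact m) ≈ qfact (suc k ℕ.+ m)
  firstPart-identity k IH zero = begin
    firstPartSum k 0 *ₚ (qfact (suc k) *ₚ onePoly)
      ≈⟨ *-cong (≈-trans (+-identityʳ _) (≈-trans (*-identityˡ _) (*-identityˡ S))) (*-congˡ onePoly (qfact-suc k)) ⟩
    S *ₚ ((qfact k *ₚ qint (suc k)) *ₚ onePoly)
      ≈⟨ solve 3 (λ F K Q → (F ⊗ ((K ⊗ Q) ⊗ Κ onePoly)) ⊜ ((F ⊗ (K ⊗ Κ onePoly)) ⊗ Q)) ≈-refl S (qfact k) (qint (suc k)) ⟩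
    (S *ₚ (qfact k *ₚ onePoly)) *ₚ qint (suc k)
      ≈⟨ *-congˡ (qint (suc k)) (≈-trans (IH 0) (≈-reflexive (cong qfact (ℕP.+-identityʳ k)))) ⟩
    qfact k *ₚ qint (suc k)  ≈⟨ qfact-suc k ⟨
    qfact (suc k)            ≡⟨ cong (qfact ∘ suc) (ℕP.+-identityʳ k) ⟨
    qfact (suc k ℕ.+ 0) ∎
    where
    S : Poly
    S = lucanomialSum k 0
  firstPart-identity k IH (suc m) = begin
    firstPartSum k (suc m) *ₚ (qfact (suc k) *ₚ qfact (suc m))
      ≈⟨ *-cong (firstPartSum-suc k m) (*-cong (qfact-suc k) (qfact-suc m)) ⟩
    (G *ₚ R +ₚ [m+2] *ₚ S₁) *ₚ ((K! *ₚ [k+1]) *ₚ (M! *ₚ [m+1]))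
      ≈⟨ solve 8 (λ G R Q₂ S₁ K! K M! M → ((G ⊗ R ⊕ Q₂ ⊗ S₁) ⊗ ((K! ⊗ K) ⊗ (M! ⊗ M)))
                   ⊜ (((G ⊗ M) ⊗ (R ⊗ ((K! ⊗ K) ⊗ M!))) ⊕ ((Q₂ ⊗ K) ⊗ (S₁ ⊗ (K! ⊗ (M! ⊗ M))))))
               ≈-refl G R [m+2] S₁ K! [k+1] M! [m+1] ⟩
    (G *ₚ [m+1]) *ₚ (R *ₚ ((K! *ₚ [k+1]) *ₚ M!)) +ₚ ([m+2] *ₚ [k+1]) *ₚ (S₁ *ₚ (K! *ₚ (M! *ₚ [m+1])))
      ≈⟨ +-cong (*-congʳ (G *ₚ [m+1]) (≈-trans (*-congʳ R (*-congˡ M! (≈-sym (qfact-suc k)))) (firstPart-identity k IH m)))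
                (*-congʳ ([m+2] *ₚ [k+1]) (≈-trans (*-congʳ S₁ (*-congʳ K! (≈-sym (qfact-suc m))))
                                                   (≈-trans (IH (suc m)) (≈-reflexive (cong qfact (ℕP.+-suc k m)))))) ⟩
    (G *ₚ [m+1]) *ₚ Z +ₚ ([m+2] *ₚ [k+1]) *ₚ Z
      ≈⟨ solve 6 (λ Q' K M Z Q₂ K₁ → (((Q' ⊗ K) ⊗ M) ⊗ Z ⊕ (Q₂ ⊗ K₁) ⊗ Z) ⊜ (Z ⊗ ((Q₂ ⊗ K₁) ⊕ Q' ⊗ (M ⊗ K))))
               ≈-refl -q (qint k) [m+1] Z [m+2] [k+1] ⟩
    Z *ₚ ([m+2] *ₚ [k+1] +ₚ -q *ₚ ([m+1] *ₚ qint k)) ≈⟨ *-congʳ Z (qint-product (suc m) k) ⟩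
    Z *ₚ qint (suc (suc m ℕ.+ k))                    ≡⟨ cong (λ z → Z *ₚ qint (suc (suc z))) (ℕP.+-comm m k) ⟩
    Z *ₚ qint (suc (suc (k ℕ.+ m)))                  ≈⟨ qfact-suc (suc (k ℕ.+ m)) ⟨
    qfact (suc (suc (k ℕ.+ m)))                      ≡⟨ cong (qfact ∘ suc) (ℕP.+-suc k m) ⟨
    qfact (suc k ℕ.+ suc m) ∎
    where
    G R [m+2] S₁ K! [k+1] M! [m+1] Z : Poly
    G = column k
    R = firstPartSum k m
    [m+2] = qint (suc (suc m))
    S₁ = lucanomialSum k (suc m)
    K! = qfact k
    [k+1] = qint (suc k)
    M! = qfact m
    [m+1] = qint (suc m)
    Z = qfact (suc (k ℕ.+ m))

  lucanomial-identity : ∀ k m → lucanomialSum k m *ₚ (qfact k *ₚ qfact m) ≈ qfact (k ℕ.+ m)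
  lucanomial-identity zero m =
    ≈-trans (*-congˡ (onePoly *ₚ qfact m) (lucanomial-zero m)) (≈-trans (*-identityˡ _) (*-identityˡ (qfact m)))
  lucanomial-identity (suc k) m =
    ≈-trans (*-congˡ (qfact (suc k) *ₚ qfact m) (lucanomialSum-suc k m)) (firstPart-identity k (lucanomial-identity k) m)

-- Part (3): the lucanomial sum is the γ-expansion over ℒ(n,k,·), and it is
-- the q-binomial coefficient by the lucanomial identity and cancellation.
module Lucanomials where

  open PolynomialRing
  open PolySums
  open GammaBasis using (γ)
  open GammaExpansion
  open PathMatchings using (path-fits; Γ-path)
  open StrictMatchings using (strictΓ; strict-fits; Γ-strict)
  open Partitions
  open LucanomialIdentity
  open ProductFormulas using (components; 2*≤⇒+≤)
  open Cancellation
  open import Data.Integer as ℤ using (1ℤ)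
  open import Data.Nat as ℕ using (ℕ; zero; suc; _∸_; _≤_)
  import Data.Nat.Properties as ℕP
  open import Data.Nat.ListAction using (sum)
  open import Data.Nat.ListAction.Properties using (sum-++)
  open import Data.List using (List; _++_; map; length; concatMap; cartesianProduct)
  import Data.List.Properties as LP
  open import Data.List.Relation.Unary.All as All using (All)
  import Data.List.Relation.Unary.All.Properties as AllP
  open import Data.Bool using (Bool)
  open import Data.Product using (_×_; _,_; proj₁; proj₂)
  open import Function using (_∘_)
  open import Relation.Binary.PropositionalEquality

  qfact-const : ∀ n → coeff (qfact n) 0 ≡ 1ℤ
  qfact-const zero = refl
  qfact-const (suc n) = trans (at (qfact-suc n) 0)
    (trans (coeff-*-zero (qfact n) (qint (suc n))) (cong (ℤ._* 1ℤ) (qfact-const n)))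

  lucanomialComponents : ℕ → ℕ → List ℕ → List Component
  lucanomialComponents n k lam = components pathMatchings lam ++ components strictMatchings (complementP n k lam)

  families : ∀ n k lam → map proj₁ (lucanomialComponents n k lam)
                           ≡ map pathMatchings lam ++ map strictMatchings (complementP n k lam)
  families n k lam = trans (LP.map-++ proj₁ (components pathMatchings lam) _)
                           (cong₂ _++_ (sym (LP.map-∘ lam)) (sym (LP.map-∘ (complementP n k lam))))

  totalSize-lucanomial : ∀ n k lam → InBox k (n ∸ k) lam → totalSize (lucanomialComponents n k lam) ≡ k ℕ.* (n ∸ k)
  totalSize-lucanomial n k lam (_ , size) = begin
    sum (map proj₂ (lucanomialComponents n k lam))
      ≡⟨ cong sum (LP.map-++ proj₂ (components pathMatchings lam) _) ⟩
    sum (map proj₂ (components pathMatchings lam) ++ map proj₂ (components strictMatchings (complementP n k lam)))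
      ≡⟨ sum-++ (map proj₂ (components pathMatchings lam)) _ ⟩
    sum (map proj₂ (components pathMatchings lam)) ℕ.+ sum (map proj₂ (components strictMatchings (complementP n k lam)))
      ≡⟨ cong₂ ℕ._+_ (cong sum (trans (sym (LP.map-∘ lam)) (LP.map-id lam)))
                     (cong sum (trans (sym (LP.map-∘ (complementP n k lam))) (trans (LP.map-id _) (complementP≡ n k lam)))) ⟩
    sum lam ℕ.+ sum (complementOf k lam (thresholds (n ∸ k))) ≡⟨ size ⟩
    k ℕ.* (n ∸ k) ∎
    where open ≡-Reasoning

  lucanomial-fit : ∀ n k lam → AllFit (lucanomialComponents n k lam)
  lucanomial-fit n k lam = AllP.++⁺ (AllP.map⁺ (All.universal path-fits lam))
                                    (AllP.map⁺ (All.universal strict-fits (complementP n k lam)))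

  Γ-lucanomial : ∀ n k lam → prodP (map (λ c → Γ (proj₁ c) (proj₂ c)) (lucanomialComponents n k lam)) ≈ weight k (n ∸ k) lam
  Γ-lucanomial n k lam = begin
    prodP (map Γc (lucanomialComponents n k lam))
      ≡⟨ cong prodP (trans (LP.map-++ Γc (components pathMatchings lam) _)
                           (cong₂ _++_ (sym (LP.map-∘ lam)) (sym (LP.map-∘ (complementP n k lam))))) ⟩
    prodP (map (λ r → Γ (pathMatchings r) r) lam ++ map (λ c → Γ (strictMatchings c) c) (complementP n k lam))
      ≈⟨ Πₚ-++ (map (λ r → Γ (pathMatchings r) r) lam) _ ⟩
    prodP (map (λ r → Γ (pathMatchings r) r) lam) *ₚ prodP (map (λ c → Γ (strictMatchings c) c) (complementP n k lam))
      ≈⟨ *-cong (Πₚ-cong lam Γ-path) (Πₚ-cong (complementP n k lam) Γ-strict) ⟩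
    prodP (map (qint ∘ suc) lam) *ₚ prodP (map strictΓ (complementP n k lam))
      ≡⟨ cong (λ z → prodP (map (qint ∘ suc) lam) *ₚ prodP (map strictΓ z)) (complementP≡ n k lam) ⟩
    weight k (n ∸ k) lam ∎
    where
    open ≈-Reasoning
    Γc : Component → Poly
    Γc c = Γ (proj₁ c) (proj₂ c)

  lucanomialTuples : ℕ → ℕ → List ℕ → List (List (List Bool))
  lucanomialTuples n k lam = seqs (map pathMatchings lam ++ map strictMatchings (complementP n k lam))

  lucanomialPairs : ℕ → ℕ → List (List ℕ × List (List Bool))
  lucanomialPairs n k = concatMap (λ lam → map (lam ,_) (lucanomialTuples n k lam)) (partitionsIn n k)

  edges : List ℕ × List (List Bool) → ℕ
  edges = totalEdges ∘ proj₂

  partitionsIn-inBox : ∀ n k → All (InBox k (n ∸ k)) (partitionsIn n k)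
  partitionsIn-inBox n k = subst (All (InBox k (n ∸ k))) (sym (boxPartitions-spec k (n ∸ k))) (boxPartitions-inBox k (n ∸ k))

  lucanomialPairs-fit : ∀ n k → All (λ x → 2 ℕ.* edges x ≤ k ℕ.* (n ∸ k)) (lucanomialPairs n k)
  lucanomialPairs-fit n k = AllP.concat⁺ (AllP.map⁺ (All.map (λ {lam} inBox → AllP.map⁺
    (subst₂ (λ D X → All (λ t → 2 ℕ.* totalEdges t ≤ D) (seqs X)) (totalSize-lucanomial n k lam inBox) (families n k lam)
            (tuples-fit (lucanomialComponents n k lam) (lucanomial-fit n k lam)))) (partitionsIn-inBox n k)))

  lucanomial-γ-expansion : ∀ n k →
    Σₚ (map (λ x → γ (edges x) (k ℕ.* (n ∸ k) ∸ 2 ℕ.* edges x)) (lucanomialPairs n k)) ≈ lucanomialSum k (n ∸ k)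
  lucanomial-γ-expansion n k = begin
    Σₚ (map γx (lucanomialPairs n k))
      ≈⟨ Σₚ-concatMap γx (λ lam → map (lam ,_) (tuples lam)) (partitionsIn n k) ⟩
    Σₚ (map (λ lam → Σₚ (map γx (map (lam ,_) (tuples lam)))) (partitionsIn n k))
      ≈⟨ Σₚ-congAll (All.map (λ {lam} inBox → per-partition lam inBox) (partitionsIn-inBox n k)) ⟩
    Σₚ (map (weight k m) (partitionsIn n k))
      ≡⟨ cong (Σₚ ∘ map (weight k m)) (boxPartitions-spec k m) ⟩
    lucanomialSum k m ∎
    where
    open ≈-Reasoning
    m d : ℕ
    m = n ∸ k
    d = k ℕ.* m
    γx : List ℕ × List (List Bool) → Poly
    γx x = γ (edges x) (d ∸ 2 ℕ.* edges x)
    tuples : List ℕ → List (List (List Bool))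
    tuples = lucanomialTuples n k
    per-partition : ∀ lam → InBox k m lam → Σₚ (map γx (map (lam ,_) (tuples lam))) ≈ weight k m lam
    per-partition lam inBox = begin
      Σₚ (map γx (map (lam ,_) (tuples lam)))  ≡⟨ Σₚ-map γx (lam ,_) (tuples lam) ⟩
      Σₚ (map (λ t → γ (totalEdges t) (d ∸ 2 ℕ.* totalEdges t)) (tuples lam))
        ≡⟨ cong₂ (λ D X → Σₚ (map (λ t → γ (totalEdges t) (D ∸ 2 ℕ.* totalEdges t)) (seqs X)))
                 (sym (totalSize-lucanomial n k lam inBox)) (sym (families n k lam)) ⟩
      Σₚ (map (λ t → γ (totalEdges t) (totalSize cs ∸ 2 ℕ.* totalEdges t)) (seqs (map proj₁ cs)))
        ≈⟨ Γ-tuples cs (lucanomial-fit n k lam) ⟩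
      prodP (map (λ c → Γ (proj₁ c) (proj₂ c)) cs)  ≈⟨ Γ-lucanomial n k lam ⟩
      weight k m lam ∎
      where
      cs : List Component
      cs = lucanomialComponents n k lam

  qbinomial≈lucanomial : ∀ n k (p : Poly) → k ≤ n →
    (∀ t → coeff (p *ₚ (qfact k *ₚ qfact (n ∸ k))) t ≡ coeff (qfact n) t) → p ≈ lucanomialSum k (n ∸ k)
  qbinomial≈lucanomial n k p k≤n p-def = cancel p (lucanomialSum k (n ∸ k)) (qfact k *ₚ qfact (n ∸ k)) const-one
    (≈-trans (coeffwise p-def) (≈-trans (≈-reflexive (cong qfact (sym (ℕP.m+[n∸m]≡n k≤n))))
                                        (≈-sym (lucanomial-identity k (n ∸ k)))))
    where
    const-one : coeff (qfact k *ₚ qfact (n ∸ k)) 0 ≡ 1ℤ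
    const-one = trans (coeff-*-zero (qfact k) (qfact (n ∸ k))) (cong₂ ℤ._*_ (qfact-const k) (qfact-const (n ∸ k)))

  qbinomial-gvec : (n k i : ℕ) → 1 ≤ n → k ≤ n → (p : Poly) →
    (∀ t → coeff (p *ₚ (qfact k *ₚ qfact (n ∸ k))) t ≡ coeff (qfact n) t) →
    2 ℕ.* i ≤ k ℕ.* (n ∸ k) →
    gvec p i ≡ altSum i (λ j → length (cartesianProduct (ℒ n k j) (ℬ (k ℕ.* (n ∸ k)) i j)))
  qbinomial-gvec n k i _ k≤n p p-def le =
    gvec-of-γ-expansion edges (lucanomialPairs n k) p (k ℕ.* (n ∸ k)) i
      (≈-trans (qbinomial≈lucanomial n k p k≤n p-def) (≈-sym (lucanomial-γ-expansion n k)))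
      (lucanomialPairs-fit n k) (2*≤⇒+≤ i _ le)

theorem4p1 : ((n i : ℕ) → 1 ≤ n → 2 * i ≤ n C 2 →
    gvec (qfact n) i
    ≡ altSum i (λ j → length (cartesianProduct (𝒯 n j) (ℬ (n C 2) i j))))
    × ((n i : ℕ) → 1 ≤ n → 2 * i ≤ suc n C 2 →
    gvec (prodOnePlusQ n) i
    ≡ altSum i (λ j → length (cartesianProduct (𝒯′ n j) (ℬ (suc n C 2) i j))))
    × ((n k i : ℕ) → 1 ≤ n → k ≤ n → (p : Poly) →
    (∀ t → coeff (p *ₚ (qfact k *ₚ qfact (n ∸ k))) t ≡ coeff (qfact n) t) →
    2 * i ≤ k * (n ∸ k) →
    gvec p i
    ≡ altSum i (λ j → length (cartesianProduct (ℒ n k j) (ℬ (k * (n ∸ k)) i j))))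
theorem4p1 = ProductFormulas.qfact-gvec , ProductFormulas.prodOnePlusQ-gvec , Lucanomials.qbinomial-gvec
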